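{- Let $\ell$ be a positive integer, let $p\geq 5$ be a prime, and let $r$ be an integer with $0<r<p$ such that $24r+1$ is a quadratic nonresidue modulo $p$. Then for all integers $n\geq 0$, $$\phi_{p\ell-1}(pn+r)\equiv 0 \pmod{2},$$ where $\phi_k(n)$ denotes Andrews' generalized Frobenius partition function (defined in the context).
   Context: For a positive integer $k$, a generalized Frobenius partition of $n$ with at most $k$ repetitions (Andrews, 1984) is a two-rowed array $$\begin{pmatrix} a_1 & a_2 & \cdots & a_s\\ b_1 & b_2 & \cdots & b_s\end{pmatrix}$$ with $s\ge 0$, where each row is a nonincreasing sequence of nonnegative integers in which each integer appears at most $k$ times, and $n=s+\sum_{i=1}^s a_i+\sum_{i=1}^s b_i$. Then $\phi_k(n)$ is the number of such arrays for $n$. Equivalently, $\sum_{n\ge0}\phi_k(n)q^n$ is the constant term (coefficient of $z^0$) of $$\prod_{m=0}^{\infty}\Big(1+zq^{m+1}+z^2q^{2(m+1)}+\cdots+z^kq^{k(m+1)}\Big)\Big(1+z^{ -1}q^{m}+z^{ -2}q^{2m}+\cdots+z^{ -k}q^{km}\Big).$$ -}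

module Defs where

open import Data.Nat using (ℕ; zero; suc; _+_; _*_; _≤_; _≥_; _≤?_; _≥?_)
import Data.Nat as N
open import Data.Nat.Properties using (_≟_)
open import Data.Nat.ListAction using (sum)
open import Data.List using (List; []; _∷_; length; map; concatMap; upTo; filter)
open import Data.List.Relation.Unary.Linked using (Linked; linked?)
open import Data.List.Relation.Unary.All using (All; all?)
open import Data.Product using (_×_; _,_; Σ; proj₁; proj₂)
open import Data.Product.Properties using ()
open import Relation.Nullary using (Dec; yes; no; ¬_)
open import Relation.Nullary.Decidable using (_×-dec_)
open import Relation.Binary.PropositionalEquality using (_≡_)
open import Data.Integer as ℤ using (ℤ; +_)
open import Data.Integer.Divisibility as ℤD using ()
open import Data.Nat.Divisibility using (_∣_)

mult : ℕ → List ℕ → ℕ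
mult x [] = 0
mult x (y ∷ ys) with x ≟ y
... | yes _ = suc (mult x ys)
... | no  _ = mult x ys

Row : ℕ → List ℕ → Set
Row k as = Linked _≥_ as × All (λ x → mult x as ≤ k) as

row? : (k : ℕ) → (as : List ℕ) → Dec (Row k as)
row? k as = linked? _≥?_ as ×-dec all? (λ x → mult x as ≤? k) as

lists : ℕ → ℕ → List (List ℕ)
lists zero    m = [] ∷ []
lists (suc s) m = concatMap (λ x → map (x ∷_) (lists s m)) (upTo (suc m))

-- A two-rowed array (top row, bottom row) counted by φ_k(n):
-- both rows are Row k, of common length s, and n = s + Σ a_i + Σ b_i.
-- (The common length is enforced by the enumeration below.)
IsGFP : ℕ → ℕ → List ℕ × List ℕ → Set
IsGFP k n (as , bs) = Row k as × Row k bs × (length as + sum as + sum bs ≡ n)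

isGFP? : (k n : ℕ) → (ab : List ℕ × List ℕ) → Dec (IsGFP k n ab)
isGFP? k n (as , bs) = row? k as ×-dec (row? k bs ×-dec (length as + sum as + sum bs ≟ n))

-- candidate arrays: s ≤ n columns, all entries ≤ n (any array for n has these bounds)
candidates : ℕ → List (List ℕ × List ℕ)
candidates n =
  concatMap (λ s → concatMap (λ as → map (as ,_) (lists s n)) (lists s n)) (upTo (suc n))

φ : ℕ → ℕ → ℕ
φ k n = length (filter (isGFP? k n) (candidates n))

QuadNonResidue : ℕ → ℕ → Set
QuadNonResidue a p =
  (¬ (p ∣ a)) × ((x : ℤ) → ¬ ((+ p) ℤD.∣ (x ℤ.* x ℤ.- + a)))

-- Transposing the two rows is an involution on generalized Frobenius partitions, so modulo 2 only the symmetric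
-- arrays count; with at most k repetitions these are counted by ∏_{i ≥ 0} (1 + x_i + ⋯ + x_i^k), x_i = q^(2i+1).
-- Modulo 2, (1 + x + ⋯ + x^k)(1 + x) = 1 + x^(k+1), and Euler's identity ∏ (1 + q^(2i+1)) ∏ (1 + q^n) ≡ 1 turns
-- the product into ∏ (1 + q^((k+1)(2i+1))) · ∏ (1 + q^n), whose second factor is ∑ q^(j(3j ± 1)/2) by the
-- pentagonal number theorem. For k + 1 = pℓ every exponent of the first factor is divisible by p, so a term
-- q^(pn+r) needs pn + r − pc = j(3j ± 1)/2, i.e. 24r + 1 ≡ (6j ± 1)² (mod p), contradicting the hypothesis.

module Submission where

open import Defs
open import Data.Nat using (ℕ; _+_; _*_; _∸_; _≤_; _<_; _≥_)
open import Data.Nat.Divisibility using (_∣_)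
open import Data.Nat.Primality using (Prime)

open import Algebra.Bundles using (CommutativeRing; CommutativeSemigroup)
open import Data.Bool using (Bool; true; false; _xor_; _∧_; not; T?)
open import Data.Bool.Properties
  using (xor-assoc; xor-same; xor-identityʳ; ∧-distribˡ-xor; ∧-distribʳ-xor; ∧-zeroʳ; ∧-identityʳ;
         not-involutive; ¬-not; xor-∧-commutativeRing)
open import Data.Empty using (⊥-elim)
import Data.Integer as ℤ
open import Data.Integer.Divisibility using () renaming (_∣_ to _ℤ∣_)
import Data.Integer.Properties as ℤ
import Data.Integer.Solver as ℤSolver
open import Data.List using (List; []; _∷_; _++_; _∷ʳ_; map; concatMap; filter; length; upTo; replicate; head)
open import Data.List.Membership.Propositional using (_∈_)
open import Data.List.Membership.Propositional.Properties using (∈-++⁻)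
import Data.List.Properties as L
open import Data.List.Relation.Unary.All using (All; []; _∷_)
import Data.List.Relation.Unary.All as All
import Data.List.Relation.Unary.All.Properties as AllP
open import Data.List.Relation.Unary.Any using (here; there)
open import Data.List.Relation.Unary.Linked using (Linked; _∷′_)
import Data.List.Relation.Unary.Linked as Linked
open import Data.List.Relation.Unary.Linked.Properties using (Linked⇒All)
open import Data.Maybe using (just)
open import Data.Maybe.Relation.Binary.Connected using (Connected; just; just-nothing)
open import Data.Nat using (zero; suc; z≤n; s≤s; _≟_; _≤?_; _<?_)
open import Data.Nat.Divisibility using (divides; _∣0; ∣m∣n⇒∣m+n; m∣m*n; ∣-trans)
open import Data.Nat.Induction using (<-rec)
open import Data.Nat.ListAction using (sum)
open import Data.Nat.Properties
  using (≤-refl; ≤-trans; ≤-pred; ≤-<-trans; m≤n⇒m≤1+n; n≤1+n; <-cmp; <⇒≤; <⇒≱; <⇒≢; >⇒≢; ≤∧≢⇒<;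
         +-comm; +-assoc; +-suc; +-identityʳ; +-mono-≤; m≤m+n; m≤n+m; m≤m*n; *-zeroʳ; *-distribˡ-+; *-mono-≤;
         m+n∸m≡n; m+[n∸m]≡n; m∸n≤m; n∸n≡0; +-∸-assoc)
open import Data.Nat.Solver using (module +-*-Solver)
open import Data.Product using (_,_; _×_; proj₁; ∃-syntax)
open import Data.Sum using (inj₁; inj₂)
open import Function using (_∘_; id)
open import Function.Bundles using (mk⇔)
open import Level using (0ℓ)
open import Relation.Binary.Bundles using (Setoid)
open import Relation.Binary.Definitions using (DecidableEquality; tri<; tri≈; tri>)
open import Relation.Binary.PropositionalEquality
  using (_≡_; _≢_; refl; sym; trans; cong; cong₂; subst; module ≡-Reasoning)
import Relation.Binary.Reasoning.Setoid as SetoidReasoning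
open import Relation.Binary.Structures using (IsEquivalence)
open import Relation.Nullary using (Dec; yes; no; does)
open import Relation.Nullary.Decidable using (dec-true; dec-false; does-⇔; _×-dec_)
open import Relation.Unary using (Decidable)

open import Algebra.Properties.CommutativeSemigroup
  (CommutativeRing.+-commutativeSemigroup xor-∧-commutativeRing)
  using (interchange; x∙yz≈y∙xz)

xor-cancelˡ : ∀ a b → a xor (a xor b) ≡ b
xor-cancelˡ a b = trans (sym (xor-assoc a a b)) (cong (_xor b) (xor-same a))

xor-telescope : ∀ a b c → (a xor b) xor (b xor c) ≡ a xor c
xor-telescope a b c = trans (xor-assoc a b (b xor c)) (cong (a xor_) (xor-cancelˡ b c))

parity : {A : Set} → (A → Bool) → List A → Bool
parity F []       = false
parity F (x ∷ xs) = F x xor parity F xs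

module _ {A : Set} where

  parity-++ : ∀ F (xs ys : List A) → parity F (xs ++ ys) ≡ parity F xs xor parity F ys
  parity-++ F []       ys = refl
  parity-++ F (x ∷ xs) ys = trans (cong (F x xor_) (parity-++ F xs ys)) (sym (xor-assoc (F x) _ _))

  parity-cong : ∀ {F G : A → Bool} → (∀ x → F x ≡ G x) → ∀ xs → parity F xs ≡ parity G xs
  parity-cong F≗G []       = refl
  parity-cong F≗G (x ∷ xs) = cong₂ _xor_ (F≗G x) (parity-cong F≗G xs)

  parity-congᴬ : ∀ {F G : A → Bool} {xs} → All (λ x → F x ≡ G x) xs → parity F xs ≡ parity G xs
  parity-congᴬ []         = refl
  parity-congᴬ (px ∷ pxs) = cong₂ _xor_ px (parity-congᴬ pxs)

  parity-false : ∀ {F : A → Bool} → (∀ x → F x ≡ false) → ∀ xs → parity F xs ≡ false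
  parity-false F≗0 []       = refl
  parity-false F≗0 (x ∷ xs) = cong₂ _xor_ (F≗0 x) (parity-false F≗0 xs)

  parity-xor : ∀ F G (xs : List A) → parity (λ x → F x xor G x) xs ≡ parity F xs xor parity G xs
  parity-xor F G []       = refl
  parity-xor F G (x ∷ xs) =
    trans (cong ((F x xor G x) xor_) (parity-xor F G xs)) (interchange (F x) (G x) _ _)

  parity-∧ˡ : ∀ b F (xs : List A) → parity (λ x → b ∧ F x) xs ≡ b ∧ parity F xs
  parity-∧ˡ b F []       = sym (∧-zeroʳ b)
  parity-∧ˡ b F (x ∷ xs) =
    trans (cong ((b ∧ F x) xor_) (parity-∧ˡ b F xs)) (sym (∧-distribˡ-xor b (F x) _))

  parity-∧ʳ : ∀ b F (xs : List A) → parity (λ x → F x ∧ b) xs ≡ parity F xs ∧ b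
  parity-∧ʳ b F []       = refl
  parity-∧ʳ b F (x ∷ xs) =
    trans (cong ((F x ∧ b) xor_) (parity-∧ʳ b F xs)) (sym (∧-distribʳ-xor b (F x) _))

  parity-filter : ∀ {P : A → Set} (P? : Decidable P) F (xs : List A) →
                  parity F (filter P? xs) ≡ parity (λ x → does (P? x) ∧ F x) xs
  parity-filter P? F []       = refl
  parity-filter P? F (x ∷ xs) with P? x
  ... | yes _ = cong (F x xor_) (parity-filter P? F xs)
  ... | no  _ = parity-filter P? F xs

module _ {A B : Set} where

  parity-map : ∀ F (g : A → B) xs → parity F (map g xs) ≡ parity (F ∘ g) xs
  parity-map F g []       = refl
  parity-map F g (x ∷ xs) = cong (F (g x) xor_) (parity-map F g xs)

  parity-concatMap : ∀ F (g : A → List B) xs →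
                     parity F (concatMap g xs) ≡ parity (λ x → parity F (g x)) xs
  parity-concatMap F g []       = refl
  parity-concatMap F g (x ∷ xs) =
    trans (parity-++ F (g x) (concatMap g xs)) (cong (parity F (g x) xor_) (parity-concatMap F g xs))

  parity-swap : ∀ (H : A → B → Bool) xs ys →
                parity (λ x → parity (H x) ys) xs ≡ parity (λ y → parity (λ x → H x y) xs) ys
  parity-swap H []       ys = sym (parity-false (λ _ → refl) ys)
  parity-swap H (x ∷ xs) ys =
    trans (cong (parity (H x) ys xor_) (parity-swap H xs ys))
          (sym (parity-xor (H x) (λ y → parity (λ x → H x y) xs) ys))

does≡true⇒ : ∀ {P : Set} (P? : Dec P) → does P? ≡ true → P
does≡true⇒ (yes p) _ = p

does-∧-true : ∀ {P : Set} (P? : Dec P) {b} → does P? ∧ b ≡ true → P × b ≡ true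
does-∧-true (yes p) b≡true = p , b≡true
does-∧-true (no _)  ()

parity-upTo-suc : ∀ F n → parity F (upTo (suc n)) ≡ F 0 xor parity (F ∘ suc) (upTo n)
parity-upTo-suc F n = cong (F 0 xor_) (trans (cong (parity F) (sym (L.map-upTo suc n))) (parity-map F suc (upTo n)))

isOdd : ℕ → Bool
isOdd zero    = false
isOdd (suc n) = not (isOdd n)

isOdd-length-filter : ∀ {A : Set} {P : A → Set} (P? : Decidable P) (xs : List A) →
                      isOdd (length (filter P? xs)) ≡ parity (does ∘ P?) xs
isOdd-length-filter P? []       = refl
isOdd-length-filter P? (x ∷ xs) with P? x
... | yes _ = cong not (isOdd-length-filter P? xs)
... | no  _ = isOdd-length-filter P? xs

isOdd≡false⇒2∣ : ∀ n → isOdd n ≡ false → 2 ∣ n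
isOdd≡false⇒2∣ zero          _ = divides 0 refl
isOdd≡false⇒2∣ (suc zero)    ()
isOdd≡false⇒2∣ (suc (suc n)) e with isOdd≡false⇒2∣ n (trans (sym (not-involutive (isOdd n))) e)
... | divides q n≡q*2 = divides (suc q) (cong (suc ∘ suc) n≡q*2)

-- Lists as multisets modulo 2

module Multiplicity {A : Set} (_≟ᴬ_ : DecidableEquality A) where

  mult₂ : A → List A → Bool
  mult₂ z = parity (λ x → does (x ≟ᴬ z))

  ≟-refl : ∀ x → does (x ≟ᴬ x) ≡ true
  ≟-refl x = dec-true (x ≟ᴬ x) refl

  mult₂-true⇒∈ : ∀ {z} xs → mult₂ z xs ≡ true → z ∈ xs
  mult₂-true⇒∈ {z} (x ∷ xs) m≡true with x ≟ᴬ z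
  ... | yes refl = here refl
  ... | no  _    = there (mult₂-true⇒∈ xs m≡true)

  remove : A → List A → List A
  remove y []       = []
  remove y (x ∷ xs) with x ≟ᴬ y
  ... | yes _ = xs
  ... | no  _ = x ∷ remove y xs

  length-remove : ∀ y xs → length (remove y xs) ≤ length xs
  length-remove y []       = z≤n
  length-remove y (x ∷ xs) with x ≟ᴬ y
  ... | yes _ = n≤1+n (length xs)
  ... | no  _ = s≤s (length-remove y xs)

  parity-remove : ∀ {y} xs → y ∈ xs → ∀ F → parity F xs ≡ F y xor parity F (remove y xs)
  parity-remove {y} (x ∷ xs) y∈ F with x ≟ᴬ y | y∈
  ... | yes refl | _         = refl
  ... | no  x≢y  | here y≡x  = ⊥-elim (x≢y (sym y≡x))
  ... | no  _    | there y∈xs =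
    trans (cong (F x xor_) (parity-remove xs y∈xs F)) (x∙yz≈y∙xz (F x) (F y) _)

  private
    vanishes : ∀ n xs → length xs ≤ n → (∀ z → mult₂ z xs ≡ false) → ∀ F → parity F xs ≡ false
    vanishes n       []       _            _     F = refl
    vanishes (suc n) (y ∷ ys) (s≤s |ys|≤n) ys≈0 F = begin
      F y xor parity F ys                         ≡⟨ cong (F y xor_) (parity-remove ys y∈ys F) ⟩
      F y xor (F y xor parity F (remove y ys))    ≡⟨ xor-cancelˡ (F y) _ ⟩
      parity F (remove y ys)                      ≡⟨ vanishes n (remove y ys) |rest|≤n rest≈0 F ⟩
      false                                       ∎
      where
      open ≡-Reasoning
      -- y occurs an even number of times in y ∷ ys, hence an odd number of times in ys
      y∈ys : y ∈ ys
      y∈ys = mult₂-true⇒∈ ys (trans (sym (not-involutive _))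
               (cong not (trans (cong (_xor mult₂ y ys) (sym (≟-refl y))) (ys≈0 y))))
      |rest|≤n : length (remove y ys) ≤ n
      |rest|≤n = ≤-trans (length-remove y ys) |ys|≤n
      rest≈0 : ∀ z → mult₂ z (remove y ys) ≡ false
      rest≈0 z = trans (sym (xor-cancelˡ (does (y ≟ᴬ z)) _))
                   (trans (cong (does (y ≟ᴬ z) xor_) (sym (parity-remove ys y∈ys _))) (ys≈0 z))

  parity-cong-mult₂ : ∀ xs ys → (∀ z → mult₂ z xs ≡ mult₂ z ys) → ∀ F → parity F xs ≡ parity F ys
  parity-cong-mult₂ []       ys xs≈ys F = sym (vanishes (length ys) ys ≤-refl (sym ∘ xs≈ys) F)
  parity-cong-mult₂ (x ∷ xs) ys xs≈ys F = begin
    F x xor parity F xs            ≡⟨ cong (F x xor_) (parity-cong-mult₂ xs (x ∷ ys) moved F) ⟩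
    F x xor (F x xor parity F ys)  ≡⟨ xor-cancelˡ (F x) _ ⟩
    parity F ys                    ∎
    where
    open ≡-Reasoning
    moved : ∀ z → mult₂ z xs ≡ mult₂ z (x ∷ ys)
    moved z = trans (sym (xor-cancelˡ (does (x ≟ᴬ z)) _)) (cong (does (x ≟ᴬ z) xor_) (xs≈ys z))

  mult₂-filter : ∀ F z xs → mult₂ z (filter (T? ∘ F) xs) ≡ F z ∧ mult₂ z xs
  mult₂-filter F z xs = trans (parity-filter (T? ∘ F) _ xs) (trans (parity-cong pick xs) (parity-∧ˡ (F z) _ xs))
    where
    pick : ∀ x → F x ∧ does (x ≟ᴬ z) ≡ F z ∧ does (x ≟ᴬ z)
    pick x with x ≟ᴬ z
    ... | yes refl = refl
    ... | no  _    = trans (∧-zeroʳ (F x)) (sym (∧-zeroʳ (F z)))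

  parity-cong-mult₂-on : ∀ F xs ys → (∀ z → F z ≡ true → mult₂ z xs ≡ mult₂ z ys) →
                         parity F xs ≡ parity F ys
  parity-cong-mult₂-on F xs ys agree = begin
    parity F xs                                 ≡⟨ filtered xs ⟩
    parity (λ _ → true) (filter (T? ∘ F) xs)    ≡⟨ parity-cong-mult₂ (filter (T? ∘ F) xs) (filter (T? ∘ F) ys) agree′ _ ⟩
    parity (λ _ → true) (filter (T? ∘ F) ys)    ≡⟨ filtered ys ⟨
    parity F ys                                 ∎
    where
    open ≡-Reasoning
    filtered : ∀ xs → parity F xs ≡ parity (λ _ → true) (filter (T? ∘ F) xs)
    filtered xs = sym (trans (parity-filter (T? ∘ F) _ xs) (parity-cong (λ x → ∧-identityʳ (F x)) xs))
    agree′ : ∀ z → mult₂ z (filter (T? ∘ F) xs) ≡ mult₂ z (filter (T? ∘ F) ys)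
    agree′ z with F z in Fz
    ... | true  = trans (mult₂-filter F z xs) (trans (cong (_∧ mult₂ z xs) Fz)
                    (trans (agree z Fz) (sym (trans (mult₂-filter F z ys) (cong (_∧ mult₂ z ys) Fz)))))
    ... | false = trans (mult₂-filter F z xs) (trans (cong (_∧ mult₂ z xs) Fz)
                    (sym (trans (mult₂-filter F z ys) (cong (_∧ mult₂ z ys) Fz))))

-- Polynomials over 𝔽₂

-- A polynomial over 𝔽₂ is the list of exponents of its monomials; repeated exponents cancel in pairs,
-- so two lists are the same polynomial when every test function has the same parity on them.
Poly : Set
Poly = List ℕ

infix 4 _≈_
record _≈_ (f g : Poly) : Set where
  constructor mk≈
  field parity-≡ : ∀ F → parity F f ≡ parity F g
open _≈_

≈-isEquivalence : IsEquivalence _≈_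
≈-isEquivalence = record
  { refl  = mk≈ λ _ → refl
  ; sym   = λ f≈g → mk≈ λ F → sym (parity-≡ f≈g F)
  ; trans = λ f≈g g≈h → mk≈ λ F → trans (parity-≡ f≈g F) (parity-≡ g≈h F)
  }

≈-setoid : Setoid 0ℓ 0ℓ
≈-setoid = record { isEquivalence = ≈-isEquivalence }

open IsEquivalence ≈-isEquivalence public
  using () renaming (refl to ≈-refl; sym to ≈-sym; trans to ≈-trans; reflexive to ≈-reflexive)

q^_ : ℕ → Poly
q^ e = e ∷ []

1ₚ : Poly
1ₚ = q^ 0

1+q^_ : ℕ → Poly
1+q^ e = 0 ∷ e ∷ []

infixl 7 _·_
-- Opaque, so that unifying implicit arguments never unfolds a product or a sum into list operations.
opaque
  _·_ : Poly → Poly → Poly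
  f · g = concatMap (λ a → map (a +_) g) f

  parity-· : ∀ F f g → parity F (f · g) ≡ parity (λ a → parity (λ b → F (a + b)) g) f
  parity-· F f g =
    trans (parity-concatMap F (λ a → map (a +_) g) f) (parity-cong (λ a → parity-map F (a +_) g) f)

  All-· : ∀ {P : ℕ → Set} → (∀ {a b} → P a → P b → P (a + b)) → ∀ {f g} → All P f → All P g → All P (f · g)
  All-· P-+ []         Pg = []
  All-· P-+ (Pa ∷ Pf)  Pg = AllP.++⁺ (AllP.map⁺ (All.map (P-+ Pa) Pg)) (All-· P-+ Pf Pg)

++-cong : ∀ {f f′ g g′} → f ≈ f′ → g ≈ g′ → f ++ g ≈ f′ ++ g′
++-cong {f} {f′} {g} {g′} f≈f′ g≈g′ = mk≈ λ F → begin
  parity F (f ++ g)             ≡⟨ parity-++ F f g ⟩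
  parity F f xor parity F g     ≡⟨ cong₂ _xor_ (parity-≡ f≈f′ F) (parity-≡ g≈g′ F) ⟩
  parity F f′ xor parity F g′   ≡⟨ parity-++ F f′ g′ ⟨
  parity F (f′ ++ g′)           ∎
  where open ≡-Reasoning

++-self : ∀ f → f ++ f ≈ []
++-self f = mk≈ λ F → trans (parity-++ F f f) (xor-same (parity F f))

++-identityʳ : ∀ f → f ++ [] ≈ f
++-identityʳ f = mk≈ λ F → trans (parity-++ F f []) (xor-identityʳ _)

++-assoc : ∀ f g h → (f ++ g) ++ h ≈ f ++ (g ++ h)
++-assoc f g h = ≈-reflexive (L.++-assoc f g h)

++-congˡ : ∀ f {g g′} → g ≈ g′ → f ++ g ≈ f ++ g′
++-congˡ f = ++-cong ≈-refl

++-congʳ : ∀ {f f′} g → f ≈ f′ → f ++ g ≈ f′ ++ g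
++-congʳ g f≈f′ = ++-cong f≈f′ ≈-refl

++-interchange : ∀ a b c d → (a ++ b) ++ (c ++ d) ≈ (a ++ c) ++ (b ++ d)
++-interchange a b c d = mk≈ λ F → begin
  parity F ((a ++ b) ++ (c ++ d))                                          ≡⟨ parity-++ F (a ++ b) (c ++ d) ⟩
  parity F (a ++ b) xor parity F (c ++ d)                                  ≡⟨ cong₂ _xor_ (parity-++ F a b) (parity-++ F c d) ⟩
  (parity F a xor parity F b) xor (parity F c xor parity F d)              ≡⟨ interchange (parity F a) _ _ _ ⟩
  (parity F a xor parity F c) xor (parity F b xor parity F d)              ≡⟨ cong₂ _xor_ (parity-++ F a c) (parity-++ F b d) ⟨
  parity F (a ++ c) xor parity F (b ++ d)                                  ≡⟨ parity-++ F (a ++ c) (b ++ d) ⟨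
  parity F ((a ++ c) ++ (b ++ d))                                          ∎
  where open ≡-Reasoning

++-cancel-middle : ∀ a x c p → (a ++ x) ++ ((c ++ x) ++ p) ≈ (a ++ c) ++ p
++-cancel-middle a x c p = begin
  (a ++ x) ++ ((c ++ x) ++ p)     ≈⟨ ++-assoc (a ++ x) (c ++ x) p ⟨
  ((a ++ x) ++ (c ++ x)) ++ p     ≈⟨ ++-congʳ p (++-interchange a x c x) ⟩
  ((a ++ c) ++ (x ++ x)) ++ p     ≈⟨ ++-congʳ p (++-congˡ (a ++ c) (++-self x)) ⟩
  ((a ++ c) ++ []) ++ p           ≈⟨ ++-congʳ p (++-identityʳ (a ++ c)) ⟩
  (a ++ c) ++ p                   ∎
  where open SetoidReasoning ≈-setoid

·-cong : ∀ {f f′ g g′} → f ≈ f′ → g ≈ g′ → f · g ≈ f′ · g′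
·-cong {f} {f′} {g} {g′} f≈f′ g≈g′ = mk≈ λ F → begin
  parity F (f · g)                                  ≡⟨ parity-· F f g ⟩
  parity (λ a → parity (λ b → F (a + b)) g) f       ≡⟨ parity-cong (λ a → parity-≡ g≈g′ _) f ⟩
  parity (λ a → parity (λ b → F (a + b)) g′) f      ≡⟨ parity-≡ f≈f′ _ ⟩
  parity (λ a → parity (λ b → F (a + b)) g′) f′     ≡⟨ parity-· F f′ g′ ⟨
  parity F (f′ · g′)                                ∎
  where open ≡-Reasoning

·-comm : ∀ f g → f · g ≈ g · f
·-comm f g = mk≈ λ F → begin
  parity F (f · g)                                  ≡⟨ parity-· F f g ⟩
  parity (λ a → parity (λ b → F (a + b)) g) f       ≡⟨ parity-swap (λ a b → F (a + b)) f g ⟩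
  parity (λ b → parity (λ a → F (a + b)) f) g       ≡⟨ parity-cong (λ b → parity-cong (λ a → cong F (+-comm a b)) f) g ⟩
  parity (λ b → parity (λ a → F (b + a)) f) g       ≡⟨ parity-· F g f ⟨
  parity F (g · f)                                  ∎
  where open ≡-Reasoning

·-assoc : ∀ f g h → (f · g) · h ≈ f · (g · h)
·-assoc f g h = mk≈ λ F → begin
  parity F ((f · g) · h)
    ≡⟨ trans (parity-· F (f · g) h) (parity-· _ f g) ⟩
  parity (λ a → parity (λ b → parity (λ c → F (a + b + c)) h) g) f
    ≡⟨ parity-cong (λ a → parity-cong (λ b → parity-cong (λ c → cong F (+-assoc a b c)) h) g) f ⟩
  parity (λ a → parity (λ b → parity (λ c → F (a + (b + c))) h) g) f
    ≡⟨ parity-cong (λ a → parity-· (λ d → F (a + d)) g h) f ⟨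
  parity (λ a → parity (λ d → F (a + d)) (g · h)) f
    ≡⟨ parity-· F f (g · h) ⟨
  parity F (f · (g · h))
    ∎
  where open ≡-Reasoning

·-identityˡ : ∀ f → 1ₚ · f ≈ f
·-identityˡ f = mk≈ λ F → trans (parity-· F 1ₚ f) (xor-identityʳ _)

·-identityʳ : ∀ f → f · 1ₚ ≈ f
·-identityʳ f = ≈-trans (·-comm f 1ₚ) (·-identityˡ f)

·-distribʳ : ∀ f g h → (f ++ g) · h ≈ f · h ++ g · h
·-distribʳ f g h = mk≈ λ F → begin
  parity F ((f ++ g) · h)                                        ≡⟨ parity-· F (f ++ g) h ⟩
  parity (λ a → parity (λ b → F (a + b)) h) (f ++ g)             ≡⟨ parity-++ _ f g ⟩
  parity (λ a → parity (λ b → F (a + b)) h) f xor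
    parity (λ a → parity (λ b → F (a + b)) h) g                  ≡⟨ cong₂ _xor_ (parity-· F f h) (parity-· F g h) ⟨
  parity F (f · h) xor parity F (g · h)                          ≡⟨ parity-++ F (f · h) (g · h) ⟨
  parity F (f · h ++ g · h)                                      ∎
  where open ≡-Reasoning

·-distribˡ : ∀ f g h → f · (g ++ h) ≈ f · g ++ f · h
·-distribˡ f g h = begin
  f · (g ++ h)       ≈⟨ ·-comm f (g ++ h) ⟩
  (g ++ h) · f       ≈⟨ ·-distribʳ g h f ⟩
  g · f ++ h · f     ≈⟨ ++-cong (·-comm g f) (·-comm h f) ⟩
  f · g ++ f · h     ∎
  where open SetoidReasoning ≈-setoid

·-commutativeSemigroup : CommutativeSemigroup 0ℓ 0ℓ
·-commutativeSemigroup = record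
  { isCommutativeSemigroup = record
    { isSemigroup = record
      { isMagma = record { isEquivalence = ≈-isEquivalence ; ∙-cong = ·-cong }
      ; assoc   = ·-assoc
      }
    ; comm = ·-comm
    }
  }

open import Algebra.Properties.CommutativeSemigroup ·-commutativeSemigroup
  using () renaming (interchange to ·-interchange; x∙yz≈y∙xz to ·-leftComm)

open Multiplicity _≟_ public
  using (parity-cong-mult₂-on) renaming (mult₂ to coeff; mult₂-true⇒∈ to coeff-true⇒∈)

coeff-shift : ∀ a j g → parity (λ b → does (a + b ≟ j)) g ≡ does (a ≤? j) ∧ coeff (j ∸ a) g
coeff-shift a j g with a ≤? j
... | yes a≤j = trans (parity-cong (λ b → does-⇔ (mk⇔ (λ a+b≡j → trans (sym (m+n∸m≡n a b)) (cong (_∸ a) a+b≡j))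
                                                      (λ b≡j∸a → trans (cong (a +_) b≡j∸a) (m+[n∸m]≡n a≤j)))
                                                 (a + b ≟ j) (b ≟ j ∸ a)) g)
                      (cong (_∧ coeff (j ∸ a) g) (sym (dec-true (a ≤? j) a≤j)))
... | no  a≰j = trans (parity-false (λ b → dec-false (a + b ≟ j) λ a+b≡j → a≰j (subst (a ≤_) a+b≡j (m≤m+n a b))) g)
                      (cong (_∧ coeff (j ∸ a) g) (sym (dec-false (a ≤? j) a≰j)))

coeff-· : ∀ j f g → coeff j (f · g) ≡ parity (λ a → does (a ≤? j) ∧ coeff (j ∸ a) g) f
coeff-· j f g = trans (parity-· _ f g) (parity-cong (λ a → coeff-shift a j g) f)

infix 4 _≈[≤_]_
record _≈[≤_]_ (f : Poly) (B : ℕ) (g : Poly) : Set where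
  constructor mk≈[≤]
  field coeff-≡ : ∀ {j} → j ≤ B → coeff j f ≡ coeff j g
open _≈[≤_]_

≈[≤]-setoid : ℕ → Setoid 0ℓ 0ℓ
≈[≤]-setoid B = record
  { Carrier       = Poly
  ; _≈_           = _≈[≤ B ]_
  ; isEquivalence = record
    { refl  = mk≈[≤] λ _ → refl
    ; sym   = λ f≈g → mk≈[≤] λ j≤B → sym (coeff-≡ f≈g j≤B)
    ; trans = λ f≈g g≈h → mk≈[≤] λ j≤B → trans (coeff-≡ f≈g j≤B) (coeff-≡ g≈h j≤B)
    }
  }

module _ {B : ℕ} where
  open Setoid (≈[≤]-setoid B) public
    using () renaming (refl to ≈[≤]-refl; sym to ≈[≤]-sym; trans to ≈[≤]-trans)

≈⇒≈[≤] : ∀ {f g} B → f ≈ g → f ≈[≤ B ] g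
≈⇒≈[≤] B f≈g = mk≈[≤] λ _ → parity-≡ f≈g _

++-cong-≤ : ∀ {f f′ g g′ B} → f ≈[≤ B ] f′ → g ≈[≤ B ] g′ → f ++ g ≈[≤ B ] f′ ++ g′
++-cong-≤ {f} {f′} {g} {g′} f≈f′ g≈g′ = mk≈[≤] λ j≤B →
  trans (parity-++ _ f g) (trans (cong₂ _xor_ (coeff-≡ f≈f′ j≤B) (coeff-≡ g≈g′ j≤B)) (sym (parity-++ _ f′ g′)))

·-cong-≤ : ∀ {f f′ g g′ B} → f ≈[≤ B ] f′ → g ≈[≤ B ] g′ → f · g ≈[≤ B ] f′ · g′
·-cong-≤ {f} {f′} {g} {g′} {B} f≈f′ g≈g′ = mk≈[≤] λ {j} j≤B → begin
  coeff j (f · g)             ≡⟨ coeff-· j f g ⟩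
  parity (H j g) f            ≡⟨ parity-cong (λ a → H-cong j≤B a) f ⟩
  parity (H j g′) f           ≡⟨ parity-cong-mult₂-on (H j g′) f f′ (λ a Ha → coeff-≡ f≈f′ (a≤B j≤B a Ha)) ⟩
  parity (H j g′) f′          ≡⟨ coeff-· j f′ g′ ⟨
  coeff j (f′ · g′)           ∎
  where
  open ≡-Reasoning
  H : ℕ → Poly → ℕ → Bool
  H j g a = does (a ≤? j) ∧ coeff (j ∸ a) g
  H-cong : ∀ {j} → j ≤ B → ∀ a → H j g a ≡ H j g′ a
  H-cong {j} j≤B a = cong (does (a ≤? j) ∧_) (coeff-≡ g≈g′ (≤-trans (m∸n≤m j a) j≤B))
  a≤B : ∀ {j} → j ≤ B → ∀ a → H j g′ a ≡ true → a ≤ B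
  a≤B {j} j≤B a Ha = ≤-trans (proj₁ (does-∧-true (a ≤? j) Ha)) j≤B

cancel-≤ : ∀ {a z B} → coeff 0 a ≡ true → a · z ≈[≤ B ] [] → z ≈[≤ B ] []
cancel-≤ {a} {z} {B} a₀ az≈0 = mk≈[≤] λ {j} → <-rec (λ j → j ≤ B → coeff j z ≡ false) step j
  where
  split : ∀ j c → does (c ≤? j) ∧ coeff (j ∸ c) a ≡ does (c ≟ j) xor (does (c <? j) ∧ coeff (j ∸ c) a)
  split j c with <-cmp c j
  ... | tri< c<j c≢j _   rewrite dec-true (c ≤? j) (<⇒≤ c<j) | dec-false (c ≟ j) c≢j | dec-true (c <? j) c<j = refl
  ... | tri≈ c≮j refl _  rewrite dec-true (c ≤? c) ≤-refl | dec-true (c ≟ c) refl | dec-false (c <? c) c≮j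
                               | n∸n≡0 c = trans a₀ (sym (xor-identityʳ true))
  ... | tri> c≮j c≢j j<c rewrite dec-false (c ≤? j) (<⇒≱ j<c) | dec-false (c ≟ j) c≢j | dec-false (c <? j) c≮j = refl
  -- coefficient j of z · a is coeff j z · a₀ plus products of lower coefficients of z
  step : ∀ j → (∀ {i} → i < j → i ≤ B → coeff i z ≡ false) → j ≤ B → coeff j z ≡ false
  step j below j≤B = begin
    coeff j z                                                        ≡⟨ xor-identityʳ _ ⟨
    coeff j z xor false                                              ≡⟨ cong (coeff j z xor_) lower ⟨
    coeff j z xor parity (λ c → does (c <? j) ∧ coeff (j ∸ c) a) z   ≡⟨ parity-xor _ _ z ⟨
    parity (λ c → does (c ≟ j) xor (does (c <? j) ∧ coeff (j ∸ c) a)) z ≡⟨ parity-cong (split j) z ⟨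
    parity (λ c → does (c ≤? j) ∧ coeff (j ∸ c) a) z                 ≡⟨ coeff-· j z a ⟨
    coeff j (z · a)                                                  ≡⟨ parity-≡ (·-comm z a) _ ⟩
    coeff j (a · z)                                                  ≡⟨ coeff-≡ az≈0 j≤B ⟩
    false                                                            ∎
    where
    open ≡-Reasoning
    lower : parity (λ c → does (c <? j) ∧ coeff (j ∸ c) a) z ≡ false
    lower = parity-cong-mult₂-on _ z [] λ c H →
      let c<j = proj₁ (does-∧-true (c <? j) H) in below c<j (≤-trans (<⇒≤ c<j) j≤B)

opaque
  ∑ : ℕ → (ℕ → Poly) → Poly
  ∑ n f = concatMap f (upTo n)

  parity-∑ : ∀ F n f → parity F (∑ n f) ≡ parity (λ i → parity F (f i)) (upTo n)
  parity-∑ F n f = parity-concatMap F f (upTo n)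

syntax ∑ n (λ i → e) = ∑[ i < n ] e

∑-zero : ∀ f → ∑ 0 f ≈ []
∑-zero f = mk≈ λ F → parity-∑ F 0 f

∑-sucʳ : ∀ n f → ∑ (suc n) f ≈ ∑ n f ++ f n
∑-sucʳ n f = mk≈ λ F → begin
  parity F (∑ (suc n) f)                               ≡⟨ parity-∑ F (suc n) f ⟩
  parity (λ i → parity F (f i)) (upTo (suc n))         ≡⟨ cong (parity _) (L.upTo-∷ʳ n) ⟨
  parity (λ i → parity F (f i)) (upTo n ∷ʳ n)        ≡⟨ parity-++ _ (upTo n) (n ∷ []) ⟩
  parity (λ i → parity F (f i)) (upTo n) xor (parity F (f n) xor false)
                                                        ≡⟨ cong₂ _xor_ (parity-∑ F n f) (sym (xor-identityʳ _)) ⟨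
  parity F (∑ n f) xor parity F (f n)                  ≡⟨ parity-++ F (∑ n f) (f n) ⟨
  parity F (∑ n f ++ f n)                              ∎
  where open ≡-Reasoning

∑-sucˡ : ∀ n f → ∑ (suc n) f ≈ f 0 ++ ∑[ i < n ] f (suc i)
∑-sucˡ n f = mk≈ λ F → begin
  parity F (∑ (suc n) f)                                             ≡⟨ parity-∑ F (suc n) f ⟩
  parity (λ i → parity F (f i)) (upTo (suc n))                       ≡⟨ parity-upTo-suc (λ i → parity F (f i)) n ⟩
  parity F (f 0) xor parity (λ i → parity F (f (suc i))) (upTo n)    ≡⟨ cong (parity F (f 0) xor_) (parity-∑ F n (f ∘ suc)) ⟨
  parity F (f 0) xor parity F (∑[ i < n ] f (suc i))                 ≡⟨ parity-++ F (f 0) _ ⟨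
  parity F (f 0 ++ ∑[ i < n ] f (suc i))                             ∎
  where open ≡-Reasoning

∑-cong : ∀ {f g} n → (∀ i → i < n → f i ≈ g i) → ∑ n f ≈ ∑ n g
∑-cong zero    f≈g = ≈-trans (∑-zero _) (≈-sym (∑-zero _))
∑-cong {f} {g} (suc n) f≈g = begin
  ∑ (suc n) f     ≈⟨ ∑-sucʳ n f ⟩
  ∑ n f ++ f n    ≈⟨ ++-cong (∑-cong n λ i i<n → f≈g i (m≤n⇒m≤1+n i<n)) (f≈g n ≤-refl) ⟩
  ∑ n g ++ g n    ≈⟨ ∑-sucʳ n g ⟨
  ∑ (suc n) g     ∎
  where open SetoidReasoning ≈-setoid

∑-++ : ∀ n f g → ∑[ i < n ] (f i ++ g i) ≈ ∑ n f ++ ∑ n g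
∑-++ n f g = mk≈ λ F → begin
  parity F (∑[ i < n ] (f i ++ g i))                               ≡⟨ parity-∑ F n _ ⟩
  parity (λ i → parity F (f i ++ g i)) (upTo n)                    ≡⟨ parity-cong (λ i → parity-++ F (f i) (g i)) (upTo n) ⟩
  parity (λ i → parity F (f i) xor parity F (g i)) (upTo n)        ≡⟨ parity-xor _ _ (upTo n) ⟩
  parity (λ i → parity F (f i)) (upTo n) xor parity (λ i → parity F (g i)) (upTo n)
                                                                    ≡⟨ cong₂ _xor_ (parity-∑ F n f) (parity-∑ F n g) ⟨
  parity F (∑ n f) xor parity F (∑ n g)                            ≡⟨ parity-++ F (∑ n f) (∑ n g) ⟨
  parity F (∑ n f ++ ∑ n g)                                        ∎
  where open ≡-Reasoning

parity-q^· : ∀ F a f → parity F (q^ a · f) ≡ parity (λ b → F (a + b)) f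
parity-q^· F a f = trans (parity-· F (q^ a) f) (xor-identityʳ _)

q^-+ : ∀ a b f → q^ (a + b) · f ≈ q^ a · (q^ b · f)
q^-+ a b f = mk≈ λ F → begin
  parity F (q^ (a + b) · f)              ≡⟨ parity-q^· F (a + b) f ⟩
  parity (λ c → F (a + b + c)) f         ≡⟨ parity-cong (λ c → cong F (+-assoc a b c)) f ⟩
  parity (λ c → F (a + (b + c))) f       ≡⟨ parity-q^· (λ d → F (a + d)) b f ⟨
  parity (λ d → F (a + d)) (q^ b · f)    ≡⟨ parity-q^· F a (q^ b · f) ⟨
  parity F (q^ a · (q^ b · f))           ∎
  where open ≡-Reasoning

q^·q^ : ∀ a b → q^ a · q^ b ≈ q^ (a + b)
q^·q^ a b = mk≈ λ F → parity-q^· F a (q^ b)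

1+q^-· : ∀ x f → 1+q^ x · f ≈ f ++ q^ x · f
1+q^-· x f = ≈-trans (·-distribʳ 1ₚ (q^ x) f) (++-cong (·-identityˡ f) ≈-refl)

coeff-q^·-low : ∀ {j e} f → j < e → coeff j (q^ e · f) ≡ false
coeff-q^·-low {j} {e} f j<e = trans (parity-q^· _ e f)
  (parity-false (λ b → dec-false (e + b ≟ j) λ e+b≡j → <⇒≱ j<e (subst (e ≤_) e+b≡j (m≤m+n e b))) f)

-- Euler's identity modulo 2

∏ : ℕ → (ℕ → Poly) → Poly
∏ zero    f = 1ₚ
∏ (suc n) f = f n · ∏ n f

syntax ∏ n (λ i → e) = ∏[ i < n ] e

∏-cong : ∀ {f g} → (∀ i → f i ≈ g i) → ∀ n → ∏ n f ≈ ∏ n g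
∏-cong f≈g zero    = ≈-refl
∏-cong f≈g (suc n) = ·-cong (f≈g n) (∏-cong f≈g n)

∏-· : ∀ f g n → ∏[ i < n ] (f i · g i) ≈ ∏ n f · ∏ n g
∏-· f g zero    = ≈-sym (·-identityˡ 1ₚ)
∏-· f g (suc n) = ≈-trans (·-cong ≈-refl (∏-· f g n)) (·-interchange (f n) (g n) (∏ n f) (∏ n g))

∏-+ : ∀ f m n → ∏ (m + n) f ≈ ∏[ i < m ] f (n + i) · ∏ n f
∏-+ f zero    n = ≈-sym (·-identityˡ _)
∏-+ f (suc m) n = begin
  f (m + n) · ∏ (m + n) f                            ≈⟨ ·-cong (≈-reflexive (cong f (+-comm m n))) (∏-+ f m n) ⟩
  f (n + m) · (∏[ i < m ] f (n + i) · ∏ n f)         ≈⟨ ·-assoc _ _ _ ⟨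
  ∏[ i < suc m ] f (n + i) · ∏ n f                   ∎
  where open SetoidReasoning ≈-setoid

∏-≈[≤]1 : ∀ {f B} → (∀ i → f i ≈[≤ B ] 1ₚ) → ∀ n → ∏ n f ≈[≤ B ] 1ₚ
∏-≈[≤]1 f≈1 zero    = ≈[≤]-refl
∏-≈[≤]1 {B = B} f≈1 (suc n) = ≈[≤]-trans (·-cong-≤ (f≈1 n) (∏-≈[≤]1 f≈1 n)) (≈⇒≈[≤] B (·-identityˡ 1ₚ))

1+q^-≈[≤]1 : ∀ {a B} → B < a → 1+q^ a ≈[≤ B ] 1ₚ
1+q^-≈[≤]1 {a} B<a = mk≈[≤] λ {j} j≤B →
  cong (does (0 ≟ j) xor_) (cong (_xor false) (dec-false (a ≟ j) λ { refl → <⇒≱ B<a j≤B }))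

1+q^-double : ∀ a → 1+q^ (a + a) ≈ 1+q^ a · 1+q^ a
1+q^-double a = mk≈ λ F → sym (trans (parity-· F (1+q^ a) (1+q^ a)) (expand (F 0) (F a) (F (a + 0)) (F (a + a))
  (cong F (+-identityʳ a))))
  where
  expand : ∀ x y y′ z → y′ ≡ y → (x xor (y xor false)) xor ((y′ xor (z xor false)) xor false) ≡ x xor (z xor false)
  expand x y _ z refl rewrite xor-identityʳ y | xor-identityʳ (y xor (z xor false)) =
    trans (xor-assoc x y _) (cong (x xor_) (xor-cancelˡ y _))

odd : ℕ → ℕ
odd i = suc (i + i)

euler : ℕ → Poly
euler B = ∏[ i < B ] 1+q^ suc i

oddEuler : ℕ → Poly
oddEuler B = ∏[ i < B ] 1+q^ odd i

evenEuler : ℕ → Poly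
evenEuler B = ∏[ i < B ] 1+q^ (suc i + suc i)

euler-odd-even : ∀ B → euler (B + B) ≈ oddEuler B · evenEuler B
euler-odd-even zero    = ≈-sym (·-identityˡ 1ₚ)
euler-odd-even (suc B) rewrite +-suc B B = begin
  e · (o · euler (B + B))                ≈⟨ ·-cong ≈-refl (·-cong ≈-refl (euler-odd-even B)) ⟩
  e · (o · (oddEuler B · evenEuler B))   ≈⟨ ·-cong ≈-refl (·-assoc o _ _) ⟨
  e · (oddEuler (suc B) · evenEuler B)   ≈⟨ ·-leftComm e _ _ ⟩
  oddEuler (suc B) · (e · evenEuler B)   ∎
  where
  open SetoidReasoning ≈-setoid
  e = 1+q^ suc (suc (B + B))
  o = 1+q^ suc (B + B)

evenEuler≈euler² : ∀ B → evenEuler B ≈ euler B · euler B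
evenEuler≈euler² B = ≈-trans (∏-cong (λ i → 1+q^-double (suc i)) B) (∏-· _ _ B)

euler-stable : ∀ B → euler (B + B) ≈[≤ B ] euler B
euler-stable B = begin
  euler (B + B)                                  ≈⟨ ≈⇒≈[≤] B (∏-+ (λ i → 1+q^ suc i) B B) ⟩
  ∏[ i < B ] (1+q^ suc (B + i)) · euler B        ≈⟨ ·-cong-≤ high≈1 ≈[≤]-refl ⟩
  1ₚ · euler B                                   ≈⟨ ≈⇒≈[≤] B (·-identityˡ (euler B)) ⟩
  euler B                                        ∎
  where
  open SetoidReasoning (≈[≤]-setoid B)
  high≈1 : ∏[ i < B ] (1+q^ suc (B + i)) ≈[≤ B ] 1ₚ
  high≈1 = ∏-≈[≤]1 (λ i → 1+q^-≈[≤]1 (s≤s (m≤m+n B i))) B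

coeff₀-euler : ∀ B → coeff 0 (euler B) ≡ true
coeff₀-euler B = coeff-≡ (∏-≈[≤]1 (λ i → 1+q^-≈[≤]1 (s≤s z≤n)) B) z≤n

-- E(q) ≡ O(q) E(q²) ≡ O(q) E(q)², and E has constant term 1, so one factor E cancels.
oddEuler·euler≈1 : ∀ B → oddEuler B · euler B ≈[≤ B ] 1ₚ
oddEuler·euler≈1 B = begin
  O · E                  ≈⟨ ≈⇒≈[≤] B (++-cong (++-self 1ₚ) ≈-refl) ⟨
  (1ₚ ++ 1ₚ) ++ O · E    ≈⟨ ≈⇒≈[≤] B (++-assoc 1ₚ 1ₚ (O · E)) ⟩
  1ₚ ++ (1ₚ ++ O · E)    ≈⟨ ++-cong-≤ ≈[≤]-refl (cancel-≤ (coeff₀-euler B) E·[1+OE]≈0) ⟩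
  1ₚ ++ []               ≈⟨ ≈⇒≈[≤] B (++-identityʳ 1ₚ) ⟩
  1ₚ                     ∎
  where
  open SetoidReasoning (≈[≤]-setoid B)
  E = euler B
  O = oddEuler B
  E≈OEE : E ≈[≤ B ] O · (E · E)
  E≈OEE = begin
    E                   ≈⟨ euler-stable B ⟨
    euler (B + B)       ≈⟨ ≈⇒≈[≤] B (euler-odd-even B) ⟩
    O · evenEuler B     ≈⟨ ≈⇒≈[≤] B (·-cong ≈-refl (evenEuler≈euler² B)) ⟩
    O · (E · E)         ∎
  E·[1+OE]≈0 : E · (1ₚ ++ O · E) ≈[≤ B ] []
  E·[1+OE]≈0 = begin
    E · (1ₚ ++ O · E)   ≈⟨ ≈⇒≈[≤] B (·-distribˡ E 1ₚ (O · E)) ⟩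
    E · 1ₚ ++ E · (O · E) ≈⟨ ≈⇒≈[≤] B (++-cong (·-identityʳ E) (·-leftComm E O E)) ⟩
    E ++ O · (E · E)    ≈⟨ ++-cong-≤ E≈OEE ≈[≤]-refl ⟩
    O · (E · E) ++ O · (E · E) ≈⟨ ≈⇒≈[≤] B (++-self (O · (E · E))) ⟩
    []                  ∎

geometric : ℕ → ℕ → Poly
geometric K x = map (_* x) (upTo K)

parity-telescope : ∀ (g : ℕ → Bool) n → parity (λ c → g c xor g (suc c)) (upTo n) ≡ g 0 xor g n
parity-telescope g zero    = sym (xor-same (g 0))
parity-telescope g (suc n) = begin
  parity (λ c → g c xor g (suc c)) (upTo (suc n))          ≡⟨ parity-upTo-suc (λ c → g c xor g (suc c)) n ⟩
  (g 0 xor g 1) xor parity (λ c → g (suc c) xor g (suc (suc c))) (upTo n)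
                                                            ≡⟨ cong ((g 0 xor g 1) xor_) (parity-telescope (g ∘ suc) n) ⟩
  (g 0 xor g 1) xor (g 1 xor g (suc n))                     ≡⟨ xor-telescope (g 0) (g 1) (g (suc n)) ⟩
  g 0 xor g (suc n)                                         ∎
  where open ≡-Reasoning

geometric·1+q^ : ∀ K x → geometric K x · 1+q^ x ≈ 1+q^ (K * x)
geometric·1+q^ K x = mk≈ λ F → begin
  parity F (geometric K x · 1+q^ x)                               ≡⟨ parity-· F _ _ ⟩
  parity (λ a → F (a + 0) xor (F (a + x) xor false)) (map (_* x) (upTo K))
                                                                  ≡⟨ parity-map _ (_* x) (upTo K) ⟩
  parity (λ c → F (c * x + 0) xor (F (c * x + x) xor false)) (upTo K)
                                                                  ≡⟨ parity-cong (step F) (upTo K) ⟩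
  parity (λ c → F (c * x) xor F (suc c * x)) (upTo K)             ≡⟨ parity-telescope (λ c → F (c * x)) K ⟩
  F 0 xor F (K * x)                                               ≡⟨ cong (F 0 xor_) (xor-identityʳ _) ⟨
  parity F (1+q^ (K * x))                                         ∎
  where
  open ≡-Reasoning
  step : ∀ F c → F (c * x + 0) xor (F (c * x + x) xor false) ≡ F (c * x) xor F (suc c * x)
  step F c = cong₂ _xor_ (cong F (+-identityʳ (c * x))) (trans (xor-identityʳ _) (cong F (+-comm (c * x) x)))

rowGF : ℕ → ℕ → Poly
rowGF K B = ∏[ i < B ] geometric K (odd i)

scaledOddEuler : ℕ → ℕ → Poly
scaledOddEuler K B = ∏[ i < B ] 1+q^ (K * odd i)

rowGF≈scaledOddEuler·euler : ∀ K B → rowGF K B ≈[≤ B ] scaledOddEuler K B · euler B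
rowGF≈scaledOddEuler·euler K B = begin
  D                  ≈⟨ ≈⇒≈[≤] B (·-identityʳ D) ⟨
  D · 1ₚ             ≈⟨ ·-cong-≤ ≈[≤]-refl (oddEuler·euler≈1 B) ⟨
  D · (O · E)        ≈⟨ ≈⇒≈[≤] B (·-assoc D O E) ⟨
  (D · O) · E        ≈⟨ ≈⇒≈[≤] B (·-cong D·O≈G ≈-refl) ⟩
  scaledOddEuler K B · E ∎
  where
  open SetoidReasoning (≈[≤]-setoid B)
  D = rowGF K B
  O = oddEuler B
  E = euler B
  D·O≈G : D · O ≈ scaledOddEuler K B
  D·O≈G = ≈-trans (≈-sym (∏-· _ _ B)) (∏-cong (λ i → geometric·1+q^ K (odd i)) B)

-- The pentagonal number theorem modulo 2

triangle : ℕ → ℕ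
triangle zero    = 0
triangle (suc k) = triangle k + suc k

segment : ℕ → ℕ → Poly
segment a d = ∏[ i < d ] 1+q^ suc (a + i)

-- Modulo 2, ∑_{k ≤ n} q^(nk + k(k+1)/2) ∏_{k < i ≤ n} (1 + q^i) is the pentagonal series up to j(3j ± 1)/2 for j ≤ n:
-- passing from n to n + 1 telescopes down to two new monomials. Its k = 0 term is euler n, the others have degree > n.
pentTerm : ℕ → ℕ → Poly
pentTerm n k = q^ (n * k + triangle k) · segment k (n ∸ k)

pentSum : ℕ → Poly
pentSum n = ∑ (suc n) (pentTerm n)

-- k(3k − 1)/2 and k(3k + 1)/2 for k = m + 1
pent⁻ pent⁺ : ℕ → ℕ
pent⁻ m = suc m * suc m + triangle m
pent⁺ m = suc m * suc m + triangle (suc m)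

pentagonalSeries : ℕ → Poly
pentagonalSeries zero    = 1ₚ
pentagonalSeries (suc m) = pentagonalSeries m ++ (q^ pent⁻ m ++ q^ pent⁺ m)

segment-peel : ∀ a d → segment a (suc d) ≈ 1+q^ suc a · segment (suc a) d
segment-peel a zero    = ·-cong (≈-reflexive (cong 1+q^_ (cong suc (+-identityʳ a)))) ≈-refl
segment-peel a (suc d) = begin
  1+q^ suc (a + suc d) · segment a (suc d)                         ≈⟨ ·-cong ≈-refl (segment-peel a d) ⟩
  1+q^ suc (a + suc d) · (1+q^ suc a · segment (suc a) d)          ≈⟨ ·-leftComm _ (1+q^ suc a) _ ⟩
  1+q^ suc a · (1+q^ suc (a + suc d) · segment (suc a) d)          ≈⟨ ·-cong ≈-refl (·-cong top ≈-refl) ⟩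
  1+q^ suc a · segment (suc a) (suc d)                             ∎
  where
  open SetoidReasoning ≈-setoid
  top : 1+q^ suc (a + suc d) ≈ 1+q^ suc (suc a + d)
  top = ≈-reflexive (cong 1+q^_ (cong suc (+-suc a d)))

segment-grow : ∀ {k m} → k ≤ m → segment k (suc m ∸ k) ≈ 1+q^ suc m · segment k (m ∸ k)
segment-grow {k} {m} k≤m rewrite +-∸-assoc 1 k≤m =
  ·-cong (≈-reflexive (cong 1+q^_ (cong suc (m+[n∸m]≡n k≤m)))) ≈-refl

pentTerm-diag : ∀ n → pentTerm n n ≈ q^ (n * n + triangle n)
pentTerm-diag n rewrite n∸n≡0 n = ·-identityʳ _

pentTerm-raise : ∀ {k m} → k ≤ m → pentTerm (suc m) k ≈ q^ k · pentTerm m k ++ q^ (k + suc m) · pentTerm m k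
pentTerm-raise {k} {m} k≤m = begin
  q^ (suc m * k + triangle k) · segment k (suc m ∸ k)     ≈⟨ ·-cong (≈-reflexive (cong q^_ (+-assoc k (m * k) _)))
                                                                    (segment-grow k≤m) ⟩
  q^ (k + e) · (1+q^ suc m · S)                           ≈⟨ q^-+ k e _ ⟩
  q^ k · (q^ e · (1+q^ suc m · S))                        ≈⟨ ·-cong ≈-refl (·-leftComm (q^ e) _ S) ⟩
  q^ k · (1+q^ suc m · C)                                 ≈⟨ ·-cong ≈-refl (1+q^-· (suc m) C) ⟩
  q^ k · (C ++ q^ suc m · C)                              ≈⟨ ·-distribˡ (q^ k) C _ ⟩
  q^ k · C ++ q^ k · (q^ suc m · C)                       ≈⟨ ++-cong ≈-refl (≈-sym (q^-+ k (suc m) C)) ⟩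
  q^ k · C ++ q^ (k + suc m) · C                          ∎
  where
  open SetoidReasoning ≈-setoid
  e = m * k + triangle k
  S = segment k (m ∸ k)
  C = pentTerm m k

pentTerm-shift : ∀ {j m} → j < m → q^ (j + suc m) · pentTerm m j ≈ pentTerm m (suc j) ++ q^ suc j · pentTerm m (suc j)
pentTerm-shift {j} {m} j<m = begin
  q^ (j + suc m) · (q^ e · segment j (m ∸ j))             ≈⟨ q^-+ _ e _ ⟨
  q^ (j + suc m + e) · segment j (m ∸ j)                  ≈⟨ ·-cong (≈-reflexive (cong q^_ exponent))
                                                                    (≈-reflexive (cong (segment j) (+-∸-assoc 1 j<m))) ⟩
  q^ e′ · segment j (suc (m ∸ suc j))                     ≈⟨ ·-cong ≈-refl (segment-peel j (m ∸ suc j)) ⟩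
  q^ e′ · (1+q^ suc j · S′)                               ≈⟨ ·-leftComm (q^ e′) _ S′ ⟩
  1+q^ suc j · C′                                         ≈⟨ 1+q^-· (suc j) C′ ⟩
  C′ ++ q^ suc j · C′                                     ∎
  where
  open SetoidReasoning ≈-setoid
  e = m * j + triangle j
  e′ = m * suc j + triangle (suc j)
  S′ = segment (suc j) (m ∸ suc j)
  C′ = pentTerm m (suc j)
  open +-*-Solver using (solve; _:+_; _:*_; con; _:=_)
  exponent : j + suc m + (m * j + triangle j) ≡ m * suc j + (triangle j + suc j)
  exponent = solve 3 (λ j m t → j :+ (con 1 :+ m) :+ (m :* j :+ t) := m :* (con 1 :+ j) :+ (t :+ (con 1 :+ j)))
                     refl j m (triangle j)

pentSum-suc : ∀ m → pentSum (suc m) ≈ pentSum m ++ (q^ pent⁻ m ++ q^ pent⁺ m)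
pentSum-suc m = begin
  ∑ (suc (suc m)) (pentTerm (suc m))
    ≈⟨ ∑-sucʳ (suc m) (pentTerm (suc m)) ⟩
  ∑ (suc m) (pentTerm (suc m)) ++ pentTerm (suc m) (suc m)
    ≈⟨ ++-cong (∑-cong (suc m) λ k k<1+m → pentTerm-raise (≤-pred k<1+m)) (pentTerm-diag (suc m)) ⟩
  ∑[ k < suc m ] (A k ++ B k) ++ q^ pent⁺ m
    ≈⟨ ++-congʳ (q^ pent⁺ m) (∑-++ (suc m) A B) ⟩
  (∑ (suc m) A ++ ∑ (suc m) B) ++ q^ pent⁺ m
    ≈⟨ ++-congʳ (q^ pent⁺ m) (++-cong (∑-sucˡ m A) (∑-sucʳ m B)) ⟩
  ((A 0 ++ A′) ++ (∑ m B ++ B m)) ++ q^ pent⁺ m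
    ≈⟨ ++-congʳ (q^ pent⁺ m) (++-congˡ (A 0 ++ A′) (++-cong (∑-cong m λ j j<m → pentTerm-shift j<m) B-top)) ⟩
  ((A 0 ++ A′) ++ (∑[ j < m ] (C (suc j) ++ A (suc j)) ++ q^ pent⁻ m)) ++ q^ pent⁺ m
    ≈⟨ ++-congʳ (q^ pent⁺ m) (++-congˡ (A 0 ++ A′) (++-congʳ (q^ pent⁻ m) (∑-++ m (C ∘ suc) (A ∘ suc)))) ⟩
  ((A 0 ++ A′) ++ ((C′ ++ A′) ++ q^ pent⁻ m)) ++ q^ pent⁺ m
    ≈⟨ ++-congʳ (q^ pent⁺ m) (++-cancel-middle (A 0) A′ C′ (q^ pent⁻ m)) ⟩
  ((A 0 ++ C′) ++ q^ pent⁻ m) ++ q^ pent⁺ m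
    ≈⟨ ++-congʳ (q^ pent⁺ m) (++-congʳ (q^ pent⁻ m) (++-congʳ C′ (·-identityˡ (C 0)))) ⟩
  ((C 0 ++ C′) ++ q^ pent⁻ m) ++ q^ pent⁺ m
    ≈⟨ ++-congʳ (q^ pent⁺ m) (++-congʳ (q^ pent⁻ m) (∑-sucˡ m C)) ⟨
  (pentSum m ++ q^ pent⁻ m) ++ q^ pent⁺ m
    ≈⟨ ++-assoc (pentSum m) _ _ ⟩
  pentSum m ++ (q^ pent⁻ m ++ q^ pent⁺ m)
    ∎
  where
  open SetoidReasoning ≈-setoid
  open +-*-Solver using (solve; _:+_; _:*_; con; _:=_)
  C A B : ℕ → Poly
  C k = pentTerm m k
  A k = q^ k · C k
  B k = q^ (k + suc m) · C k
  A′ = ∑[ j < m ] A (suc j)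
  C′ = ∑[ j < m ] C (suc j)
  B-top : B m ≈ q^ pent⁻ m
  B-top = begin
    q^ (m + suc m) · C m                      ≈⟨ ·-cong ≈-refl (pentTerm-diag m) ⟩
    q^ (m + suc m) · q^ (m * m + triangle m)  ≈⟨ q^·q^ (m + suc m) _ ⟩
    q^ (m + suc m + (m * m + triangle m))     ≈⟨ ≈-reflexive (cong q^_ (solve 2 (λ m t → m :+ (con 1 :+ m) :+ (m :* m :+ t)
                                                   := (con 1 :+ m) :* (con 1 :+ m) :+ t) refl m (triangle m))) ⟩
    q^ pent⁻ m                                ∎

pentSum≈pentagonalSeries : ∀ n → pentSum n ≈ pentagonalSeries n
pentSum≈pentagonalSeries zero    = begin
  ∑ 1 (pentTerm 0)                ≈⟨ ∑-sucʳ 0 (pentTerm 0) ⟩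
  ∑ 0 (pentTerm 0) ++ pentTerm 0 0 ≈⟨ ++-cong (∑-zero (pentTerm 0)) (pentTerm-diag 0) ⟩
  1ₚ                              ∎
  where open SetoidReasoning ≈-setoid
pentSum≈pentagonalSeries (suc m) = ≈-trans (pentSum-suc m) (++-cong (pentSum≈pentagonalSeries m) ≈-refl)

euler≈pentSum : ∀ n → euler n ≈[≤ n ] pentSum n
euler≈pentSum n = mk≈[≤] λ {j} j≤n → sym (begin
  coeff j (pentSum n)
    ≡⟨ trans (parity-∑ _ (suc n) (pentTerm n)) (parity-upTo-suc (λ k → coeff j (pentTerm n k)) n) ⟩
  coeff j (pentTerm n 0) xor parity (λ k → coeff j (pentTerm n (suc k))) (upTo n)
    ≡⟨ cong (coeff j (pentTerm n 0) xor_) (parity-false (λ k → coeff-q^·-low _ (high j≤n k)) (upTo n)) ⟩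
  coeff j (pentTerm n 0) xor false
    ≡⟨ xor-identityʳ _ ⟩
  coeff j (q^ (n * 0 + 0) · euler n)
    ≡⟨ cong (λ e → coeff j (q^ e · euler n)) (trans (+-identityʳ _) (*-zeroʳ n)) ⟩
  coeff j (q^ 0 · euler n)
    ≡⟨ parity-≡ (·-identityˡ (euler n)) _ ⟩
  coeff j (euler n)
    ∎)
  where
  open ≡-Reasoning
  high : ∀ {j} → j ≤ n → ∀ k → j < n * suc k + triangle (suc k)
  high {j} j≤n k = ≤-trans (s≤s j≤n) (subst (_≤ n * suc k + triangle (suc k)) (+-comm n 1)
    (+-mono-≤ (m≤m*n n (suc k)) (≤-trans (s≤s z≤n) (m≤n+m (suc k) (triangle k)))))

euler-coeff-pentagonal : ∀ {j B} → j ≤ B → coeff j (euler B) ≡ true → j ∈ pentagonalSeries B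
euler-coeff-pentagonal {j} {B} j≤B coeff≡true = coeff-true⇒∈ (pentagonalSeries B) (begin
  coeff j (pentagonalSeries B)   ≡⟨ parity-≡ (pentSum≈pentagonalSeries B) _ ⟨
  coeff j (pentSum B)            ≡⟨ coeff-≡ (euler≈pentSum B) j≤B ⟨
  coeff j (euler B)              ≡⟨ coeff≡true ⟩
  true                           ∎)
  where open ≡-Reasoning

scaledOddEuler-multiples : ∀ K B → All (K ∣_) (scaledOddEuler K B)
scaledOddEuler-multiples K zero    = (K ∣0) ∷ []
scaledOddEuler-multiples K (suc B) =
  All-· ∣m∣n⇒∣m+n ((K ∣0) ∷ m∣m*n (odd B) ∷ []) (scaledOddEuler-multiples K B)

-- Vanishing coefficients

triangle-double : ∀ k → 2 * triangle k ≡ k * suc k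
triangle-double zero    = refl
triangle-double (suc k) = begin
  2 * (triangle k + suc k)        ≡⟨ *-distribˡ-+ 2 (triangle k) (suc k) ⟩
  2 * triangle k + 2 * suc k      ≡⟨ cong (_+ 2 * suc k) (triangle-double k) ⟩
  k * suc k + 2 * suc k           ≡⟨ solve 1 (λ k → k :* (con 1 :+ k) :+ con 2 :* (con 1 :+ k)
                                               := (con 1 :+ k) :* (con 2 :+ k)) refl k ⟩
  suc k * suc (suc k)             ∎
  where
  open ≡-Reasoning
  open +-*-Solver using (solve; _:+_; _:*_; con; _:=_)

square-via-triangle : ∀ x s {t u} → 2 * t ≡ u → x * x ≡ 24 * s + 12 * u + 1 → x * x ≡ 24 * (s + t) + 1
square-via-triangle x s {t} refl x² = trans x² (solve 2 (λ s t → con 24 :* s :+ con 12 :* (con 2 :* t) :+ con 1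
                                                                  := con 24 :* (s :+ t) :+ con 1) refl s t)
  where open +-*-Solver using (solve; _:+_; _:*_; con; _:=_)

-- 24 k(3k ∓ 1)/2 + 1 = (6k ∓ 1)²
pentagonal-square : ∀ {j} n → j ∈ pentagonalSeries n → ∃[ x ] x * x ≡ 24 * j + 1
pentagonal-square zero    (here refl) = 1 , refl
pentagonal-square (suc m) j∈ with ∈-++⁻ (pentagonalSeries m) j∈
... | inj₁ j∈′                 = pentagonal-square m j∈′
... | inj₂ (here refl)         = 6 * m + 5 , square-via-triangle (6 * m + 5) (suc m * suc m) (triangle-double m)
  (solve 1 (λ m → (con 6 :* m :+ con 5) :* (con 6 :* m :+ con 5)
                  := con 24 :* ((con 1 :+ m) :* (con 1 :+ m)) :+ con 12 :* (m :* (con 1 :+ m)) :+ con 1) refl m)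
  where open +-*-Solver using (solve; _:+_; _:*_; con; _:=_)
... | inj₂ (there (here refl)) = 6 * m + 7 , square-via-triangle (6 * m + 7) (suc m * suc m) (triangle-double (suc m))
  (solve 1 (λ m → (con 6 :* m :+ con 7) :* (con 6 :* m :+ con 7)
                  := con 24 :* ((con 1 :+ m) :* (con 1 :+ m)) :+ con 12 :* ((con 1 :+ m) :* (con 2 :+ m)) :+ con 1) refl m)
  where open +-*-Solver using (solve; _:+_; _:*_; con; _:=_)
square-congruence : ∀ {p r n c j x} → c * p + j ≡ p * n + r → x * x ≡ 24 * j + 1 →
                    ℤ.+ p ℤ∣ ℤ.+ x ℤ.* ℤ.+ x ℤ.- ℤ.+ (24 * r + 1)
square-congruence {p} {r} {n} {c} {j} {x} c*p+j≡p*n+r sq =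
  subst (λ z → p ∣ ℤ.∣ z ∣) (sym difference) (subst (p ∣_) (sym (ℤ.abs-* (ℤ.+ p) _)) (m∣m*n _))
  where
  open ≡-Reasoning
  open ℤSolver.+-*-Solver using (solve; _:+_; _:*_; _:-_; con; _:=_)
  ↑_ : ℕ → ℤ.ℤ
  ↑ a = ℤ.+ a
  24a+1 : ∀ a → ↑ (24 * a + 1) ≡ ↑ 24 ℤ.* ↑ a ℤ.+ ↑ 1
  24a+1 a = trans (ℤ.pos-+ (24 * a) 1) (cong (ℤ._+ ↑ 1) (ℤ.pos-* 24 a))
  ab+k : ∀ a b k → ↑ (a * b + k) ≡ ↑ a ℤ.* ↑ b ℤ.+ ↑ k
  ab+k a b k = trans (ℤ.pos-+ (a * b) k) (cong (ℤ._+ ↑ k) (ℤ.pos-* a b))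
  vanishing : ↑ c ℤ.* ↑ p ℤ.+ ↑ j ℤ.- (↑ p ℤ.* ↑ n ℤ.+ ↑ r) ≡ ↑ 0
  vanishing = begin
    ↑ c ℤ.* ↑ p ℤ.+ ↑ j ℤ.- (↑ p ℤ.* ↑ n ℤ.+ ↑ r)   ≡⟨ cong₂ ℤ._-_ (ab+k c p j) (ab+k p n r) ⟨
    ↑ (c * p + j) ℤ.- ↑ (p * n + r)                 ≡⟨ cong (λ z → ↑ z ℤ.- ↑ (p * n + r)) c*p+j≡p*n+r ⟩
    ↑ (p * n + r) ℤ.- ↑ (p * n + r)                 ≡⟨ ℤ.+-inverseʳ (↑ (p * n + r)) ⟩
    ↑ 0                                             ∎
  difference : ↑ x ℤ.* ↑ x ℤ.- ↑ (24 * r + 1) ≡ ↑ p ℤ.* (↑ 24 ℤ.* (↑ n ℤ.- ↑ c))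
  difference = begin
    ↑ x ℤ.* ↑ x ℤ.- ↑ (24 * r + 1)
      ≡⟨ cong₂ ℤ._-_ (trans (sym (ℤ.pos-* x x)) (trans (cong ↑_ sq) (24a+1 j))) (24a+1 r) ⟩
    (↑ 24 ℤ.* ↑ j ℤ.+ ↑ 1) ℤ.- (↑ 24 ℤ.* ↑ r ℤ.+ ↑ 1)
      ≡⟨ solve 5 (λ p n c j r → (con (↑ 24) :* j :+ con (↑ 1)) :- (con (↑ 24) :* r :+ con (↑ 1))
                   := p :* (con (↑ 24) :* (n :- c)) :+ con (↑ 24) :* (c :* p :+ j :- (p :* n :+ r)))
                 refl (↑ p) (↑ n) (↑ c) (↑ j) (↑ r) ⟩
    ↑ p ℤ.* (↑ 24 ℤ.* (↑ n ℤ.- ↑ c)) ℤ.+ ↑ 24 ℤ.* (↑ c ℤ.* ↑ p ℤ.+ ↑ j ℤ.- (↑ p ℤ.* ↑ n ℤ.+ ↑ r))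
      ≡⟨ cong (λ z → ↑ p ℤ.* (↑ 24 ℤ.* (↑ n ℤ.- ↑ c)) ℤ.+ ↑ 24 ℤ.* z) vanishing ⟩
    ↑ p ℤ.* (↑ 24 ℤ.* (↑ n ℤ.- ↑ c)) ℤ.+ ↑ 24 ℤ.* ↑ 0
      ≡⟨ solve 1 (λ z → z :+ con (↑ 24) :* con (↑ 0) := z) refl _ ⟩
    ↑ p ℤ.* (↑ 24 ℤ.* (↑ n ℤ.- ↑ c))
      ∎

rowGF-coeff-vanishes : ∀ {K p r n B} → p ∣ K → QuadNonResidue (24 * r + 1) p → p * n + r ≤ B →
                       coeff (p * n + r) (rowGF K B) ≡ false
rowGF-coeff-vanishes {K} {p} {r} {n} {B} p∣K (_ , nonresidue) N≤B = begin
  coeff N (rowGF K B)                                              ≡⟨ coeff-≡ (rowGF≈scaledOddEuler·euler K B) N≤B ⟩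
  coeff N (scaledOddEuler K B · euler B)                           ≡⟨ coeff-· N (scaledOddEuler K B) (euler B) ⟩
  parity (λ a → does (a ≤? N) ∧ coeff (N ∸ a) (euler B)) (scaledOddEuler K B)
                                                                   ≡⟨ parity-congᴬ (All.map term (scaledOddEuler-multiples K B)) ⟩
  parity (λ _ → false) (scaledOddEuler K B)                        ≡⟨ parity-false (λ _ → refl) (scaledOddEuler K B) ⟩
  false                                                            ∎
  where
  open ≡-Reasoning
  N = p * n + r
  term : ∀ {a} → K ∣ a → does (a ≤? N) ∧ coeff (N ∸ a) (euler B) ≡ false
  term {a} K∣a = ¬-not λ term≡true →
    let (a≤N , coeff≡true) = does-∧-true (a ≤? N) term≡true
        (x , x²)           = pentagonal-square B (euler-coeff-pentagonal (≤-trans (m∸n≤m N a) N≤B) coeff≡true)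
        divides c a≡c*p    = ∣-trans p∣K K∣a
        c*p+[N∸a]≡N        = trans (cong (_+ (N ∸ a)) (sym a≡c*p)) (m+[n∸m]≡n a≤N)
    in nonresidue (ℤ.+ x) (square-congruence {c = c} {j = N ∸ a} {x = x} c*p+[N∸a]≡N x²)

-- Generalized Frobenius partitions

mult-++ : ∀ y xs ys → mult y (xs ++ ys) ≡ mult y xs + mult y ys
mult-++ y []       ys = refl
mult-++ y (x ∷ xs) ys with y ≟ x
... | yes _ = cong suc (mult-++ y xs ys)
... | no  _ = mult-++ y xs ys

mult-replicate : ∀ y c → mult y (replicate c y) ≡ c
mult-replicate y zero    = refl
mult-replicate y (suc c) with y ≟ y
... | yes _   = cong suc (mult-replicate y c)
... | no y≢y  = ⊥-elim (y≢y refl)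

mult-absent : ∀ {y} xs → All (y ≢_) xs → mult y xs ≡ 0
mult-absent         []       []            = refl
mult-absent {y} (x ∷ xs) (y≢x ∷ y∉xs) with y ≟ x
... | yes y≡x = ⊥-elim (y≢x y≡x)
... | no  _   = mult-absent xs y∉xs

All-concatMap⁺ : ∀ {A B : Set} {P : B → Set} {f : A → List B} {xs} → All (λ x → All P (f x)) xs → All P (concatMap f xs)
All-concatMap⁺ = AllP.concat⁺ ∘ AllP.map⁺

Row-replicate-++ : ∀ {k B c a} → c ≤ k → All (_< B) a → Row k a → Row k (replicate c B ++ a)
Row-replicate-++ {k} {B} {c} {a} c≤k a<B (linked , bounded) =
  linked-prefix c , AllP.++⁺ (AllP.replicate⁺ c run) (All.zipWith below (a<B , bounded))
  where
  run : mult B (replicate c B ++ a) ≤ k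
  run rewrite mult-++ B (replicate c B) a | mult-replicate B c
            | mult-absent a (All.map >⇒≢ a<B) | +-identityʳ c = c≤k
  below : ∀ {y} → y < B × mult y a ≤ k → mult y (replicate c B ++ a) ≤ k
  below {y} (y<B , mult≤k) rewrite mult-++ y (replicate c B) a
                                 | mult-absent (replicate c B) (AllP.replicate⁺ c (<⇒≢ y<B)) = mult≤k
  linked-prefix : ∀ c → Linked _≥_ (replicate c B ++ a)
  linked-prefix zero    = linked
  linked-prefix (suc c) = head-≤ c a<B ∷′ linked-prefix c
    where
    head-≤ : ∀ c {a} → All (_< B) a → Connected _≥_ (just B) (head (replicate c B ++ a))
    head-≤ (suc c) _           = just ≤-refl
    head-≤ zero    []          = just-nothing
    head-≤ zero    (x<B ∷ _)   = just (<⇒≤ x<B)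

Row-++⁻ʳ : ∀ {k} xs {ys} → Row k (xs ++ ys) → Row k ys
Row-++⁻ʳ {k} xs {ys} (linked , bounded) =
  Linked-++⁻ʳ xs linked , All.map (λ {y} mult≤k → ≤-trans (subst (mult y ys ≤_) (sym (mult-++ y xs ys)) (m≤n+m _ _)) mult≤k)
                                  (AllP.++⁻ʳ xs bounded)
  where
  Linked-++⁻ʳ : ∀ xs {ys} → Linked _≥_ (xs ++ ys) → Linked _≥_ ys
  Linked-++⁻ʳ []       linked = linked
  Linked-++⁻ʳ (x ∷ xs) linked = Linked-++⁻ʳ xs (Linked.tail linked)

lead : ℕ → List ℕ → ℕ
lead B []       = 0
lead B (x ∷ z) with x ≟ B
... | yes _ = suc (lead B z)
... | no  _ = 0

rest : ℕ → List ℕ → List ℕ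
rest B []       = []
rest B (x ∷ z) with x ≟ B
... | yes _ = rest B z
... | no  _ = x ∷ z

lead-rest : ∀ B z → replicate (lead B z) B ++ rest B z ≡ z
lead-rest B []      = refl
lead-rest B (x ∷ z) with x ≟ B
... | yes refl = cong (x ∷_) (lead-rest B z)
... | no  _    = refl

lead-replicate-++ : ∀ {B a} c → All (_< B) a → lead B (replicate c B ++ a) ≡ c
lead-replicate-++ {B} (suc c) a<B with B ≟ B
... | yes _   = cong suc (lead-replicate-++ c a<B)
... | no B≢B  = ⊥-elim (B≢B refl)
lead-replicate-++ zero []                    = refl
lead-replicate-++ {B} {x ∷ _} zero (x<B ∷ _) with x ≟ B
... | yes x≡B = ⊥-elim (<⇒≢ x<B x≡B)
... | no  _   = refl

rest-replicate-++ : ∀ {B a} c → All (_< B) a → rest B (replicate c B ++ a) ≡ a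
rest-replicate-++ {B} (suc c) a<B with B ≟ B
... | yes _   = rest-replicate-++ c a<B
... | no B≢B  = ⊥-elim (B≢B refl)
rest-replicate-++ zero []                    = refl
rest-replicate-++ {B} {x ∷ _} zero (x<B ∷ _) with x ≟ B
... | yes x≡B = ⊥-elim (<⇒≢ x<B x≡B)
... | no  _   = refl

mult-head : ∀ x z → mult x (x ∷ z) ≡ suc (mult x z)
mult-head x z with x ≟ x
... | yes _   = refl
... | no x≢x  = ⊥-elim (x≢x refl)

lead≤mult : ∀ B z → lead B z ≤ mult B z
lead≤mult B []      = z≤n
lead≤mult B (x ∷ z) with x ≟ B
... | yes refl = subst (suc (lead x z) ≤_) (sym (mult-head x z)) (s≤s (lead≤mult x z))
... | no  _    = z≤n

Row-lead : ∀ {k} B z → Row k z → lead B z ≤ k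
Row-lead B []      _                  = z≤n
Row-lead B (x ∷ z) (_ , mult≤k ∷ _) with x ≟ B
... | yes refl = ≤-trans (s≤s (lead≤mult x z)) (subst (_≤ _) (mult-head x z) mult≤k)
... | no  _    = z≤n

rest-bounded : ∀ B z → Linked _≥_ z → All (_< suc B) z → All (_< B) (rest B z)
rest-bounded B []      _      _              = []
rest-bounded B (x ∷ z) linked (x≤B ∷ z≤B) with x ≟ B
... | yes _   = rest-bounded B z (Linked.tail linked) z≤B
... | no  x≢B = All.map (λ y≤x → ≤-<-trans y≤x x<B) (Linked⇒All (λ y≥z z≥w → ≤-trans z≥w y≥z) ≤-refl linked)
  where
  x<B : x < B
  x<B = ≤∧≢⇒< (≤-pred x≤B) x≢B

open Multiplicity (L.≡-dec _≟_) using () renaming (mult₂ to mult₂ᴸ; parity-cong-mult₂-on to parity-cong-mult₂ᴸ-on)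

coeff-upTo : ∀ x n → coeff x (upTo n) ≡ does (x <? n)
coeff-upTo x       zero    = refl
coeff-upTo zero    (suc n) = trans (parity-upTo-suc (λ c → does (c ≟ 0)) n) (cong (true xor_) (parity-false (λ _ → refl) (upTo n)))
coeff-upTo (suc x) (suc n) = trans (parity-upTo-suc (λ c → does (c ≟ suc x)) n) (coeff-upTo x n)

-- each nonincreasing list with entries < B, every entry occurring fewer than K times, exactly once
rows : ℕ → ℕ → List (List ℕ)
rows K zero    = [] ∷ []
rows K (suc B) = concatMap (λ c → map (replicate c B ++_) (rows K B)) (upTo K)

rows-bounded : ∀ K B → All (All (_< B)) (rows K B)
rows-bounded K zero    = [] ∷ []
rows-bounded K (suc B) = All-concatMap⁺ (AllP.applyUpTo⁺₂ id K λ c → AllP.map⁺ (All.map prefix (rows-bounded K B)))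
  where
  prefix : ∀ {c a} → All (_< B) a → All (_< suc B) (replicate c B ++ a)
  prefix {c} a<B = AllP.++⁺ (AllP.replicate⁺ c ≤-refl) (All.map m≤n⇒m≤1+n a<B)

rows-Row : ∀ k B → All (Row k) (rows (suc k) B)
rows-Row k zero    = (Linked.[] , []) ∷ []
rows-Row k (suc B) = All-concatMap⁺ (AllP.applyUpTo⁺₁ id (suc k) λ c<1+k →
  AllP.map⁺ (All.zipWith (λ (a<B , row) → Row-replicate-++ (≤-pred c<1+k) a<B row) (rows-bounded (suc k) B , rows-Row k B)))

rows-complete : ∀ k B z → Row k z → All (_< B) z → mult₂ᴸ z (rows (suc k) B) ≡ true
rows-complete k zero    [] _   []     = refl
rows-complete k (suc B) z  row z<1+B = begin
  mult₂ᴸ z (rows (suc k) (suc B))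
    ≡⟨ parity-concatMap _ (λ c → map (replicate c B ++_) (rows (suc k) B)) (upTo (suc k)) ⟩
  parity (λ c → mult₂ᴸ z (map (replicate c B ++_) (rows (suc k) B))) (upTo (suc k))
    ≡⟨ parity-cong column (upTo (suc k)) ⟩
  coeff (lead B z) (upTo (suc k))
    ≡⟨ coeff-upTo (lead B z) (suc k) ⟩
  does (lead B z <? suc k)
    ≡⟨ dec-true (lead B z <? suc k) (s≤s (Row-lead B z row)) ⟩
  true
    ∎
  where
  open ≡-Reasoning
  _≟ᴸ_ = L.≡-dec _≟_
  Rs = rows (suc k) B
  rest∈rows : mult₂ᴸ (rest B z) Rs ≡ true
  rest∈rows = rows-complete k B (rest B z)
    (Row-++⁻ʳ (replicate (lead B z) B) (subst (Row k) (sym (lead-rest B z)) row)) (rest-bounded B z (proj₁ row) z<1+B)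
  split : ∀ c {a} → All (_< B) a → does ((replicate c B ++ a) ≟ᴸ z) ≡ does (c ≟ lead B z) ∧ does (a ≟ᴸ rest B z)
  split c {a} a<B = does-⇔ (mk⇔ (λ { refl → sym (lead-replicate-++ c a<B) , sym (rest-replicate-++ c a<B) })
                                (λ { (refl , refl) → lead-rest B z }))
                           ((replicate c B ++ a) ≟ᴸ z) ((c ≟ lead B z) ×-dec (a ≟ᴸ rest B z))
  column : ∀ c → mult₂ᴸ z (map (replicate c B ++_) Rs) ≡ does (c ≟ lead B z)
  column c = begin
    mult₂ᴸ z (map (replicate c B ++_) Rs)
      ≡⟨ parity-map (λ x → does (x ≟ᴸ z)) (replicate c B ++_) Rs ⟩
    parity (λ a → does ((replicate c B ++ a) ≟ᴸ z)) Rs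
      ≡⟨ parity-congᴬ (All.map (split c) (rows-bounded (suc k) B)) ⟩
    parity (λ a → does (c ≟ lead B z) ∧ does (a ≟ᴸ rest B z)) Rs
      ≡⟨ parity-∧ˡ (does (c ≟ lead B z)) (λ a → does (a ≟ᴸ rest B z)) Rs ⟩
    does (c ≟ lead B z) ∧ mult₂ᴸ (rest B z) Rs
      ≡⟨ trans (cong (does (c ≟ lead B z) ∧_) rest∈rows) (∧-identityʳ _) ⟩
    does (c ≟ lead B z)
      ∎

-- n = s + Σ a_i + Σ b_i for the diagonal array with a = b = z
weight : List ℕ → ℕ
weight z = length z + sum z + sum z

weight-replicate-++ : ∀ c B a → weight (replicate c B ++ a) ≡ c * odd B + weight a
weight-replicate-++ zero    B a = refl
weight-replicate-++ (suc c) B a = begin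
  suc (length z + (B + sum z) + (B + sum z))   ≡⟨ solve 3 (λ B l s → con 1 :+ l :+ (B :+ s) :+ (B :+ s)
                                                             := con 1 :+ (B :+ B) :+ (l :+ s :+ s)) refl B (length z) (sum z) ⟩
  odd B + weight z                             ≡⟨ cong (odd B +_) (weight-replicate-++ c B a) ⟩
  odd B + (c * odd B + weight a)               ≡⟨ +-assoc (odd B) (c * odd B) (weight a) ⟨
  suc c * odd B + weight a                     ∎
  where
  open ≡-Reasoning
  open +-*-Solver using (solve; _:+_; _:*_; con; _:=_)
  z = replicate c B ++ a

weights-rows : ∀ K B → map weight (rows K B) ≈ rowGF K B
weights-rows K zero    = ≈-refl
weights-rows K (suc B) = ≈-trans (mk≈ λ F → begin
  parity F (map weight (rows K (suc B)))
    ≡⟨ trans (parity-map F weight (rows K (suc B)))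
             (parity-concatMap (F ∘ weight) (λ c → map (replicate c B ++_) (rows K B)) (upTo K)) ⟩
  parity (λ c → parity (F ∘ weight) (map (replicate c B ++_) (rows K B))) (upTo K)
    ≡⟨ parity-cong (λ c → trans (parity-map (F ∘ weight) (replicate c B ++_) (rows K B))
                         (trans (parity-cong (λ a → cong F (weight-replicate-++ c B a)) (rows K B))
                                (sym (parity-map (λ w → F (c * odd B + w)) weight (rows K B))))) (upTo K) ⟩
  parity (λ c → parity (λ w → F (c * odd B + w)) (map weight (rows K B))) (upTo K)
    ≡⟨ parity-map (λ a → parity (λ w → F (a + w)) (map weight (rows K B))) (_* odd B) (upTo K) ⟨
  parity (λ a → parity (λ w → F (a + w)) (map weight (rows K B))) (geometric K (odd B))
    ≡⟨ parity-· F (geometric K (odd B)) (map weight (rows K B)) ⟨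
  parity F (geometric K (odd B) · map weight (rows K B))
    ∎) (·-cong ≈-refl (weights-rows K B))
  where open ≡-Reasoning

lists-length : ∀ s m → All (λ l → length l ≡ s) (lists s m)
lists-length zero    m = refl ∷ []
lists-length (suc s) m = All-concatMap⁺ (AllP.applyUpTo⁺₂ id (suc m) λ x → AllP.map⁺ (All.map (cong suc) (lists-length s m)))

lists-complete : ∀ {m} z → All (_≤ m) z → ∀ s → mult₂ᴸ z (lists s m) ≡ does (s ≟ length z)
lists-complete []      _            zero    = refl
lists-complete (_ ∷ _) _            zero    = refl
lists-complete {m} []      _            (suc s) =
  trans (parity-concatMap _ (λ x → map (x ∷_) (lists s m)) (upTo (suc m)))
        (parity-false (λ x → trans (parity-map _ (x ∷_) (lists s m)) (parity-false (λ _ → refl) (lists s m))) (upTo (suc m)))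
lists-complete {m} (x ∷ z) (x≤m ∷ z≤m) (suc s) = begin
  mult₂ᴸ (x ∷ z) (lists (suc s) m)
    ≡⟨ parity-concatMap _ (λ y → map (y ∷_) (lists s m)) (upTo (suc m)) ⟩
  parity (λ y → mult₂ᴸ (x ∷ z) (map (y ∷_) (lists s m))) (upTo (suc m))
    ≡⟨ parity-cong (λ y → trans (parity-map _ (y ∷_) (lists s m)) (parity-∧ˡ (does (y ≟ x)) _ (lists s m))) (upTo (suc m)) ⟩
  parity (λ y → does (y ≟ x) ∧ mult₂ᴸ z (lists s m)) (upTo (suc m))
    ≡⟨ trans (parity-cong (λ y → cong (does (y ≟ x) ∧_) (lists-complete z z≤m s)) (upTo (suc m)))
             (parity-∧ʳ (does (s ≟ length z)) (λ y → does (y ≟ x)) (upTo (suc m))) ⟩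
  coeff x (upTo (suc m)) ∧ does (s ≟ length z)
    ≡⟨ cong (_∧ does (s ≟ length z)) (trans (coeff-upTo x (suc m)) (dec-true (x <? suc m) (s≤s x≤m))) ⟩
  does (s ≟ length z)
    ∎
  where open ≡-Reasoning

parity-diagonal : ∀ {A : Set} {P : A → Set} (H : A → A → Bool) → (∀ {a b} → P a → P b → H a b ≡ H b a) →
                  ∀ {M} → All P M → parity (λ a → parity (H a) M) M ≡ parity (λ a → H a a) M
parity-diagonal H H-sym []                 = refl
parity-diagonal H H-sym {x ∷ M} (Px ∷ PM) = begin
  parity (H x) (x ∷ M) xor parity (λ a → H a x xor parity (H a) M) M
    ≡⟨ cong (parity (H x) (x ∷ M) xor_) (parity-xor (λ a → H a x) (λ a → parity (H a) M) M) ⟩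
  (H x x xor parity (H x) M) xor (parity (λ a → H a x) M xor parity (λ a → parity (H a) M) M)
    ≡⟨ cong₂ (λ u v → (H x x xor parity (H x) M) xor (u xor v))
             (parity-congᴬ (All.map (λ Pa → H-sym Pa Px) PM)) (parity-diagonal H H-sym PM) ⟩
  (H x x xor parity (H x) M) xor (parity (H x) M xor parity (λ a → H a a) M)
    ≡⟨ xor-telescope (H x x) (parity (H x) M) _ ⟩
  H x x xor parity (λ a → H a a) M
    ∎
  where open ≡-Reasoning

diagonalCandidates : ℕ → List (List ℕ)
diagonalCandidates N = concatMap (λ s → lists s N) (upTo (suc N))

isOdd-φ≡diagonal : ∀ k N → isOdd (φ k N) ≡ parity (λ z → does (isGFP? k N (z , z))) (diagonalCandidates N)
isOdd-φ≡diagonal k N = begin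
  isOdd (φ k N)
    ≡⟨ isOdd-length-filter (isGFP? k N) (candidates N) ⟩
  parity G (candidates N)
    ≡⟨ parity-concatMap G (λ s → concatMap (λ as → map (as ,_) (lists s N)) (lists s N)) (upTo (suc N)) ⟩
  parity (λ s → parity G (concatMap (λ as → map (as ,_) (lists s N)) (lists s N))) (upTo (suc N))
    ≡⟨ parity-cong (λ s → trans (parity-concatMap G (λ as → map (as ,_) (lists s N)) (lists s N))
                          (parity-cong (λ as → parity-map G (as ,_) (lists s N)) (lists s N))) (upTo (suc N)) ⟩
  parity (λ s → parity (λ as → parity (λ bs → G (as , bs)) (lists s N)) (lists s N)) (upTo (suc N))
    ≡⟨ parity-cong (λ s → parity-diagonal (λ as bs → G (as , bs)) (λ {as} {bs} → G-sym {as = as} {bs}) (lists-length s N))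
                   (upTo (suc N)) ⟩
  parity (λ s → parity (λ z → G (z , z)) (lists s N)) (upTo (suc N))
    ≡⟨ parity-concatMap (λ z → G (z , z)) (λ s → lists s N) (upTo (suc N)) ⟨
  parity (λ z → G (z , z)) (diagonalCandidates N)
    ∎
  where
  open ≡-Reasoning
  open +-*-Solver using (solve; _:+_; _:=_)
  G : List ℕ × List ℕ → Bool
  G = does ∘ isGFP? k N
  transpose : ∀ {as bs} → length as ≡ length bs → IsGFP k N (as , bs) → IsGFP k N (bs , as)
  transpose {as} {bs} |as|≡|bs| (row-a , row-b , size) = row-b , row-a , trans (sym swap) size
    where
    swap : length as + sum as + sum bs ≡ length bs + sum bs + sum as
    swap rewrite |as|≡|bs| = solve 3 (λ l a b → l :+ a :+ b := l :+ b :+ a) refl (length bs) (sum as) (sum bs)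
  G-sym : ∀ {s as bs} → length as ≡ s → length bs ≡ s → G (as , bs) ≡ G (bs , as)
  G-sym {as = as} {bs} |as| |bs| = does-⇔ (mk⇔ (transpose (trans |as| (sym |bs|))) (transpose (trans |bs| (sym |as|))))
                                            (isGFP? k N (as , bs)) (isGFP? k N (bs , as))

All-≤-sum : ∀ z → All (_≤ sum z) z
All-≤-sum []      = []
All-≤-sum (x ∷ z) = m≤m+n x (sum z) ∷ All.map (λ y≤ → ≤-trans y≤ (m≤n+m (sum z) x)) (All-≤-sum z)

isOdd-φ : ∀ k N → isOdd (φ k N) ≡ coeff N (rowGF (suc k) (suc N))
isOdd-φ k N = begin
  isOdd (φ k N)
    ≡⟨ isOdd-φ≡diagonal k N ⟩
  parity diagonal (diagonalCandidates N)
    ≡⟨ parity-cong-mult₂ᴸ-on diagonal (diagonalCandidates N) (rows (suc k) (suc N)) both-complete ⟩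
  parity diagonal (rows (suc k) (suc N))
    ≡⟨ parity-congᴬ (All.map diagonal-Row (rows-Row k (suc N))) ⟩
  parity (λ z → does (weight z ≟ N)) (rows (suc k) (suc N))
    ≡⟨ parity-map (λ w → does (w ≟ N)) weight (rows (suc k) (suc N)) ⟨
  coeff N (map weight (rows (suc k) (suc N)))
    ≡⟨ parity-≡ (weights-rows (suc k) (suc N)) _ ⟩
  coeff N (rowGF (suc k) (suc N))
    ∎
  where
  open ≡-Reasoning
  diagonal : List ℕ → Bool
  diagonal z = does (isGFP? k N (z , z))
  diagonal-Row : ∀ {z} → Row k z → diagonal z ≡ does (weight z ≟ N)
  diagonal-Row {z} row = cong (λ b → b ∧ (b ∧ does (weight z ≟ N))) (dec-true (row? k z) row)
  both-complete : ∀ z → diagonal z ≡ true → mult₂ᴸ z (diagonalCandidates N) ≡ mult₂ᴸ z (rows (suc k) (suc N))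
  both-complete z isGFP with does≡true⇒ (isGFP? k N (z , z)) isGFP
  ... | row , _ , weight≡N = trans in-candidates (sym (rows-complete k (suc N) z row (All.map s≤s z≤N)))
    where
    sum≤N : sum z ≤ N
    sum≤N = subst (sum z ≤_) weight≡N (≤-trans (m≤n+m (sum z) (length z)) (m≤m+n _ (sum z)))
    z≤N : All (_≤ N) z
    z≤N = All.map (λ x≤sum → ≤-trans x≤sum sum≤N) (All-≤-sum z)
    |z|≤N : length z ≤ N
    |z|≤N = subst (length z ≤_) weight≡N (≤-trans (m≤m+n (length z) (sum z)) (m≤m+n _ (sum z)))
    in-candidates : mult₂ᴸ z (diagonalCandidates N) ≡ true
    in-candidates = begin
      mult₂ᴸ z (diagonalCandidates N)
        ≡⟨ parity-concatMap (λ x → does (L.≡-dec _≟_ x z)) (λ s → lists s N) (upTo (suc N)) ⟩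
      parity (λ s → mult₂ᴸ z (lists s N)) (upTo (suc N))     ≡⟨ parity-cong (lists-complete z z≤N) (upTo (suc N)) ⟩
      coeff (length z) (upTo (suc N))                         ≡⟨ coeff-upTo (length z) (suc N) ⟩
      does (length z <? suc N)                                ≡⟨ dec-true (length z <? suc N) (s≤s |z|≤N) ⟩
      true                                                    ∎

theorem3 : (ℓ p r : ℕ) → 1 ≤ ℓ → Prime p → p ≥ 5 → 0 < r → r < p →
    QuadNonResidue (24 * r + 1) p →
    (n : ℕ) → 2 ∣ φ (p * ℓ ∸ 1) (p * n + r)
theorem3 ℓ p r 1≤ℓ _ p≥5 _ _ nonresidue n = isOdd≡false⇒2∣ (φ k N) (begin
  isOdd (φ k N)                      ≡⟨ isOdd-φ k N ⟩
  coeff N (rowGF (suc k) (suc N))    ≡⟨ cong (λ K → coeff N (rowGF K (suc N))) suc-k≡p*ℓ ⟩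
  coeff N (rowGF (p * ℓ) (suc N))    ≡⟨ rowGF-coeff-vanishes (m∣m*n ℓ) nonresidue (n≤1+n N) ⟩
  false                              ∎)
  where
  open ≡-Reasoning
  k = p * ℓ ∸ 1
  N = p * n + r
  suc-k≡p*ℓ : suc k ≡ p * ℓ
  suc-k≡p*ℓ = m+[n∸m]≡n (*-mono-≤ (≤-trans (s≤s z≤n) p≥5) 1≤ℓ)
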